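{- Let $a,b,n$ be nonnegative integers and $1\le u_1<\dots<u_n\le b+2n$ integers with $V_{a,b,n,(u_i)_1^n}$ tileable. (1) If $u_1=2$, then $F_{b,n,(u_i)_1^n}(a)\equiv_a F_{b,n-1,(u_i-2)_{i=2}^n}(a+1)$ and $f_{b,n,(u_i)_1^n}(a)=f_{b,n-1,(u_i-2)_{i=2}^n}(a+1)$. (2) If $u_n=b+2n$, then $F_{b,n,(u_i)_1^n}(a)\equiv_a F_{b+1,n-1,(u_i)_{i=1}^{n-1}}(a)$ and $f_{b,n,(u_i)_1^n}(a)=f_{b+1,n-1,(u_i)_{i=1}^{n-1}}(a)$.
   Context: Work on the triangular lattice of the plane with some lattice lines horizontal; its unit equilateral triangles are called triangles. A lozenge is the union of two triangles sharing an edge; a lozenge tiling of a region (a union of triangles) is a covering of it by lozenges contained in it with pairwise disjoint interiors; $M(R)$ is the number of lozenge tilings of $R$. $H_{a,b,c,t}$ is the equiangular hexagonal region with side lengths $a,b+t,c,a+t,b,c+t$ read clockwise from the northern (horizontal) side. For $1\le u_1<\dots<u_m\le b+t$ and $1\le v_1<\dots<v_k\le c+t$, $H_{a,b,c,t,(u_i)_1^m,(v_j)_1^k}$ is obtained from $H_{a,b,c,t}$ by removing the $u_i$-th triangle along the northeast side (counting from the north the triangles sharing an edge with that side) for each $i$, and the $v_j$-th triangle along the northwest side (counted likewise) for each $j$. For nonnegative integers $a,b,n$ and an increasing integer vector $(w_1,\dots,w_n)$ with $1\le w_1$, $w_n\le b+2n$, the region $H_{2a,b,b,2n,(w_i)_1^n,(w_i)_1^n}$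 is symmetric about a vertical line $L$, and $V_{a,b,n,(w_i)_1^n}$ is the region of its triangles whose interiors lie strictly west of $L$; $f_{b,n,(w_i)_1^n}(a)=M(V_{a,b,n,(w_i)_1^n})$. For such a vector (indexed $w_1,\dots,w_n$ in order), set $\underline{w_i}=b+n+i-w_i$ and $$F_{b,n,(w_i)_1^n}(a)=\frac{P_{|}(a,b+n)}{\prod_{i=1}^n(2a+w_i)_{\underline{w_i}}},$$ where $(x)_k=x(x+1)\cdots(x+k-1)$ and $P_{|}(a,b)=\frac{(a+1)_{b-1}}{(2a+1)_{b-1}}\prod_{1\le i\le j\le b-1}\frac{2a+i+j-1}{i+j-1}$. The vector $(u_i-2)_{i=2}^n$ means $(u_2-2,\dots,u_n-2)$, of length $n-1$. For rational functions $g_1,g_2$ (possibly in several variables) that are polynomials in $a$, $g_1\equiv_a g_2$ means there is some $c$, not identically zero and independent of $a$, with $g_1=c\cdot g_2$. -}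

module Defs where

open import Data.Nat using (ℕ; zero; suc; _+_; _*_; _∸_; _⊓_; _≡ᵇ_; _%_)
open import Data.Bool using (Bool; true; false; _∧_; _∨_)
open import Data.Product using (_×_; _,_; proj₁; proj₂)
open import Data.List using (List; []; _∷_; map; _++_; length; filterᵇ; cartesianProduct; concatMap; upTo; allFin)
open import Data.Bool.ListAction using (all; any)
open import Data.Fin using (Fin)
open import Data.Integer using (+_)
open import Data.Rational using (ℚ; _/_; 0ℚ)

-- Horizontal lattice lines; the horizontal strips between
-- consecutive lines are numbered by a depth s (s = 0 is the strip just
-- below a fixed horizontal line, s grows southwards).  Within a strip,
-- a triangle is determined by the horizontal position of its centre;
-- in units of half an edge the centre positions in a strip are all
-- integers, and we write the position as -k (k ∈ ℕ), so that larger k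
-- means further WEST; the fixed vertical line L is the line k = 0.
-- A triangle (s , k) is pointing up iff s + k is even (this fixes the
-- alignment of the lattice).  Two triangles share an edge iff they are
-- (s , k) and (s , k ± 1), or an up-triangle (s , k) and the
-- down-triangle (s + 1 , k) directly below its horizontal base.
-- All regions used here lie in s ≥ 0, k ≥ 1, so ℕ × ℕ suffices.

Tri : Set
Tri = ℕ × ℕ

isUp : Tri → Bool
isUp (s , k) = ((s + k) % 2) ≡ᵇ 0

eqTri : Tri → Tri → Bool
eqTri (s , k) (s' , k') = (s ≡ᵇ s') ∧ (k ≡ᵇ k')

upDownAdj : Tri → Tri → Bool
upDownAdj (s , k) (s' , k') =
  isUp (s , k) ∧
  (((s' ≡ᵇ s) ∧ ((k' ≡ᵇ suc k) ∨ (k ≡ᵇ suc k'))) ∨ ((s' ≡ᵇ suc s) ∧ (k' ≡ᵇ k)))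

-- A region is a finite set of triangles, given as a duplicate-free list.
Region : Set
Region = List Tri

-- A lozenge = union of two triangles sharing an edge, recorded as the
-- pair (up-triangle , down-triangle).  The lozenges contained in R:
lozengesIn : Region → List (Tri × Tri)
lozengesIn R = filterᵇ (λ p → upDownAdj (proj₁ p) (proj₂ p)) (cartesianProduct R R)

covers : Tri → Tri × Tri → Bool
covers t (t₁ , t₂) = eqTri t t₁ ∨ eqTri t t₂

sublists : {A : Set} → List A → List (List A)
sublists [] = [] ∷ []
sublists (x ∷ xs) = map (x ∷_) (sublists xs) ++ sublists xs

isTiling : Region → List (Tri × Tri) → Bool
isTiling R S = all (λ t → length (filterᵇ (covers t) S) ≡ᵇ 1) R

M : Region → ℕ
M R = length (filterᵇ (isTiling R) (sublists (lozengesIn R)))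

-- The regions V_{a,b,n,(w_i)}
-- H_{2a,b,b,2n} placed with its northern side on the line above strip
-- s = 0 and its symmetry axis on L (k = 0).  In strip s (0 ≤ s < 2b+2n)
-- it contains exactly the triangles with |centre| ≤ hexBound a b n s
-- (half-edge units): the NE/NW sides have length b+2n, SE/SW sides b,
-- north side 2a, south side 2a+2n.
hexBound : ℕ → ℕ → ℕ → ℕ → ℕ
hexBound a b n s = (2 * a + s) ⊓ ((2 * a + 2 * b + 4 * n) ∸ suc s)

-- The w-th triangle (counted from the north) along the northwest side
-- is the westmost (up-)triangle of strip s = w - 1, at k = 2a + s.
-- (By symmetry the removed triangles on the northeast side lie east of L.)
isRemoved : ℕ → (n : ℕ) → (Fin n → ℕ) → Tri → Bool
isRemoved a n w (s , k) =
  any (λ i → suc s ≡ᵇ w i) (allFin n) ∧ (k ≡ᵇ 2 * a + s)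

-- V_{a,b,n,(w_i)} : triangles of H_{2a,b,b,2n,(w_i),(w_i)} strictly west of L
-- (i.e. k ≥ 1).
V : ℕ → ℕ → (n : ℕ) → (Fin n → ℕ) → Region
V a b n w =
  filterᵇ (λ t → Data.Bool.not (isRemoved a n w t))
    (concatMap (λ s → map (λ k → (s , suc k)) (upTo (hexBound a b n s)))
               (upTo (2 * b + 2 * n)))

f : (b n : ℕ) → (Fin n → ℕ) → ℕ → ℕ
f b n w a = M (V a b n w)

poch : ℕ → ℕ → ℕ
poch x zero = 1
poch x (suc k) = x * poch (suc x) k

prod : ℕ → (ℕ → ℕ) → ℕ
prod zero g = 1
prod (suc m) g = prod m g * g m

prodFin : (n : ℕ) → (Fin n → ℕ) → ℕ
prodFin zero g = 1
prodFin (suc n) g = g Fin.zero * prodFin n (λ i → g (Fin.suc i))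

-- ∏_{1 ≤ i ≤ j ≤ m} g i j
prodTri : ℕ → (ℕ → ℕ → ℕ) → ℕ
prodTri m g = prod m (λ i' → prod (m ∸ i') (λ j' → g (suc i') (suc i' + j')))

-- P_|(a,B) = numP a B / denP a B
numP : ℕ → ℕ → ℕ
numP a B = poch (suc a) (B ∸ 1) * prodTri (B ∸ 1) (λ i j → 2 * a + i + j ∸ 1)

denP : ℕ → ℕ → ℕ
denP a B = poch (2 * a + 1) (B ∸ 1) * prodTri (B ∸ 1) (λ i j → i + j ∸ 1)

-- ∏_{i=1}^n (2a + w_i)_{b+n+i-w_i}   (Fin index i' corresponds to i = i'+1)
denW : (b n : ℕ) → (Fin n → ℕ) → ℕ → ℕ
denW b n w a = prodFin n (λ i → poch (2 * a + w i) (b + n + suc (Data.Fin.toℕ i) ∸ w i))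

-- n / d as a rational (d = 0 never occurs for the vectors considered).
ratio : ℕ → ℕ → ℚ
ratio n zero = 0ℚ
ratio n (suc d) = (+ n) / suc d

F : (b n : ℕ) → (Fin n → ℕ) → ℕ → ℚ
F b n w a = ratio (numP a (b + n)) (denP a (b + n) * denW b n w a)

open import Relation.Binary.PropositionalEquality using (_≡_; _≢_)
open import Data.Product using (Σ)
import Data.Rational as Q

_≡ₐ_ : (ℕ → ℚ) → (ℕ → ℚ) → Set
g₁ ≡ₐ g₂ = Σ ℚ (λ c → (c ≢ 0ℚ) × ((a : ℕ) → g₁ a ≡ c Q.* g₂ a))

open import Data.Nat using (_≤_; _<_)
import Data.Fin as Fin

Admissible : (b n : ℕ) → (Fin n → ℕ) → Set
Admissible b n w =
  ((i : Fin n) → (1 ≤ w i) × (w i ≤ b + 2 * n)) ×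
  ((i j : Fin n) → i Fin.< j → w i < w j)

module Submission where

-- Removing a lozenge that is the only one covering some triangle does not change the number of
-- tilings, and in both cases the distinguished removed triangle starts a chain of such forced
-- lozenges. If u₁ = 2, the top row of V is forced from east to west and then the second row,
-- whose westmost triangle is the removed one, from west to east; what is left is
-- V_{a+1,b,n-1,(uᵢ-2)} shifted two rows down. If uₙ = b + 2n, the removed triangle is the
-- western end of row b + 2n - 1, and below it the two westmost triangles of each row form a
-- forced lozenge; what is left is V_{a,b+1,n-1,(uᵢ)}. On the side of F, case (2) is an identity
-- because the last rising factorial is empty, while in case (1) the first one, (2a + 2)_{b+n-1},
-- together with P(a, b + n) is a constant multiple of P(a + 1, b + n - 1).

open import Data.Bool using (Bool; true; false; _∧_; _∨_; not; T; T?)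
open import Data.Bool.ListAction using (all; and; any)
open import Data.Bool.Properties using (∧-comm; ∧-zeroʳ; ∧-identityʳ; ∨-zeroʳ)
open import Data.Empty using (⊥; ⊥-elim)
open import Data.Fin as Fin using (Fin; zero; suc; fromℕ; inject₁; toℕ; lower₁)
open import Data.Fin.Properties using (toℕ-fromℕ; toℕ-inject₁; toℕ-injective; inject₁-lower₁)
import Data.Integer as ℤ
import Data.Integer.Properties as ℤₚ
open import Data.List using (List; []; _∷_; _++_; map; length; filterᵇ; concat; concatMap; cartesianProduct; upTo; applyUpTo; allFin)
open import Data.List.Properties
  using ( filter-++; filter-all; length-++; length-map; map-++; map-∘; map-cong; map-cong-local
        ; map-applyUpTo; map-upTo; map-concatMap; upTo-∷ʳ; ++-identityʳ; ∷-injective )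
open import Data.List.Membership.Propositional using (_∈_; lose; find)
open import Data.List.Membership.Propositional.Properties
  using ( ∈-filter⁺; ∈-filter⁻; ∈-map⁺; ∈-map⁻; ∈-++⁺ˡ; ∈-++⁺ʳ; ∈-upTo⁺; ∈-upTo⁻; ∈-concatMap⁺; ∈-concatMap⁻
        ; ∈-cartesianProduct⁺; ∈-cartesianProduct⁻; ∈-allFin )
open import Data.List.Relation.Binary.Permutation.Propositional using (_↭_; ↭-refl; prep; swap)
open import Data.List.Relation.Binary.Permutation.Propositional.Properties using (↭-length; filter-↭)
open import Data.List.Relation.Unary.All as All using (All; []; _∷_)
import Data.List.Relation.Unary.All.Properties as Allₚ
open import Data.List.Relation.Unary.AllPairs using ([]; _∷_)
open import Data.List.Relation.Unary.Any using (Any; here; there)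
open import Data.List.Relation.Unary.Unique.Propositional using (Unique)
import Data.List.Relation.Unary.Unique.Propositional.Properties as Unique
open import Data.Nat as ℕ using (ℕ; zero; suc; _+_; _*_; _∸_; _⊓_; _≡ᵇ_; _%_; _<_; _≤_; z≤n; s≤s; z<s)
open import Data.Nat.DivMod using (m*n%n≡0; [m+kn]%n≡m%n)
open import Data.Nat.Properties
open import Data.Nat.Tactic.RingSolver using (solve-∀)
open import Data.Product using (_×_; _,_; proj₁; proj₂; ∃; ∃₂)
open import Data.Rational as ℚ using (0ℚ; 1ℚ; Positive)
import Data.Rational.Properties as ℚₚ
open import Data.Rational.Unnormalised using (mkℚᵘ; *≡*)
import Data.Rational.Unnormalised.Properties as ℚᵘ
open import Data.Sum using (_⊎_; inj₁; inj₂)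
open import Data.Unit using (⊤; tt)
open import Function using (_∘_; case_of_)
open import Relation.Binary.Definitions using (tri<; tri≈; tri>)
open import Relation.Binary.PropositionalEquality
open import Relation.Nullary using (yes; no)
open import Defs

private variable
  X Y : Set

≡true⇒T : ∀ {b} → b ≡ true → T b
≡true⇒T refl = tt

T⇒≡true : ∀ {b} → T b → b ≡ true
T⇒≡true {true} _ = refl

∧-≡true : ∀ {a b} → a ∧ b ≡ true → a ≡ true × b ≡ true
∧-≡true {true} {true} _ = refl , refl

∧-≡false : ∀ {a b} → a ∧ b ≡ false → a ≡ false ⊎ b ≡ false
∧-≡false {false}         _ = inj₁ refl
∧-≡false {true}  {false} _ = inj₂ refl

∨-≡true : ∀ {a b} → a ∨ b ≡ true → a ≡ true ⊎ b ≡ true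
∨-≡true {true}         _ = inj₁ refl
∨-≡true {false} {true} _ = inj₂ refl

not-≡true : ∀ {a} → not a ≡ true → a ≡ false
not-≡true {false} _ = refl

not-≡false : ∀ {a} → not a ≡ false → a ≡ true
not-≡false {true} _ = refl

Bool-ext : ∀ {b c} → (b ≡ true → c ≡ true) → (c ≡ true → b ≡ true) → b ≡ c
Bool-ext {false} {false} _ _ = refl
Bool-ext {false} {true}  _ c⇒b = c⇒b refl
Bool-ext {true}          b⇒c _ = sym (b⇒c refl)

true≢false : true ≢ false
true≢false ()

≡ᵇ-refl : ∀ n → (n ≡ᵇ n) ≡ true
≡ᵇ-refl n = T⇒≡true (≡⇒≡ᵇ n n refl)

≡ᵇ⇒≡′ : ∀ {m n} → (m ≡ᵇ n) ≡ true → m ≡ n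
≡ᵇ⇒≡′ {m} {n} e = ≡ᵇ⇒≡ m n (≡true⇒T e)

all-cong : (g h : X → Bool) (xs : List X) → (∀ x → g x ≡ h x) → all g xs ≡ all h xs
all-cong g h xs g≗h = cong and (map-cong g≗h xs)

all-false : (g : X → Bool) {x : X} (xs : List X) → x ∈ xs → g x ≡ false → all g xs ≡ false
all-false g (y ∷ xs) (here refl) gx rewrite gx = refl
all-false g (y ∷ xs) (there x∈xs) gx with g y
... | true  = all-false g xs x∈xs gx
... | false = refl

all-filterᵇ : (g h p : X → Bool) (xs : List X) → (∀ x → p x ≡ false → g x ≡ true) →
  (∀ x → p x ≡ true → g x ≡ h x) → all g xs ≡ all h (filterᵇ p xs)
all-filterᵇ g h p []       _     _     = refl
all-filterᵇ g h p (x ∷ xs) g-out g≗h with p x in px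
... | true  = cong₂ _∧_ (g≗h x px) (all-filterᵇ g h p xs g-out g≗h)
... | false rewrite g-out x px = all-filterᵇ g h p xs g-out g≗h

filterᵇ-accept : (p : X → Bool) {x : X} {xs : List X} → p x ≡ true → filterᵇ p (x ∷ xs) ≡ x ∷ filterᵇ p xs
filterᵇ-accept p px rewrite px = refl

filterᵇ-reject : (p : X → Bool) {x : X} {xs : List X} → p x ≡ false → filterᵇ p (x ∷ xs) ≡ filterᵇ p xs
filterᵇ-reject p px rewrite px = refl

filterᵇ-none : (p : X → Bool) {xs : List X} → All (λ x → p x ≡ false) xs → filterᵇ p xs ≡ []
filterᵇ-none p []         = refl
filterᵇ-none p (px ∷ pxs) = trans (filterᵇ-reject p px) (filterᵇ-none p pxs)

filterᵇ-cong : (p q : X → Bool) {xs : List X} → All (λ x → p x ≡ q x) xs → filterᵇ p xs ≡ filterᵇ q xs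
filterᵇ-cong p q {[]}     []           = refl
filterᵇ-cong p q {x ∷ xs} (px≡qx ∷ eqs) with p x | q x
... | true  | true  = cong (x ∷_) (filterᵇ-cong p q eqs)
... | false | false = filterᵇ-cong p q eqs
filterᵇ-cong p q {x ∷ xs} (() ∷ _) | true  | false
filterᵇ-cong p q {x ∷ xs} (() ∷ _) | false | true

filterᵇ-map : (p : Y → Bool) (g : X → Y) (xs : List X) → filterᵇ p (map g xs) ≡ map g (filterᵇ (λ x → p (g x)) xs)
filterᵇ-map p g []       = refl
filterᵇ-map p g (x ∷ xs) with p (g x)
... | true  = cong (g x ∷_) (filterᵇ-map p g xs)
... | false = filterᵇ-map p g xs

filterᵇ-filterᵇ : (p q : X → Bool) (xs : List X) → filterᵇ p (filterᵇ q xs) ≡ filterᵇ (λ x → q x ∧ p x) xs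
filterᵇ-filterᵇ p q []       = refl
filterᵇ-filterᵇ p q (x ∷ xs) with q x
... | false = filterᵇ-filterᵇ p q xs
... | true with p x
...   | true  = cong (x ∷_) (filterᵇ-filterᵇ p q xs)
...   | false = filterᵇ-filterᵇ p q xs

filterᵇ-satisfies : (p : X → Bool) (xs : List X) → All (λ x → p x ≡ true) (filterᵇ p xs)
filterᵇ-satisfies p []       = []
filterᵇ-satisfies p (x ∷ xs) with p x in px
... | true  = px ∷ filterᵇ-satisfies p xs
... | false = filterᵇ-satisfies p xs

filterᵇ-singleton : (p : X → Bool) (L : List X) {ℓ : X} → filterᵇ p L ≡ ℓ ∷ [] →
  ∃ λ L₁ → ∃ λ L₂ → L ≡ L₁ ++ ℓ ∷ L₂ × All (λ x → p x ≡ false) L₁ × All (λ x → p x ≡ false) L₂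
filterᵇ-singleton p (x ∷ L) e with p x in px
... | true with ∷-injective e
...   | refl , rest = [] , L , refl , [] , rejected L rest
  where rejected : ∀ ys → filterᵇ p ys ≡ [] → All (λ y → p y ≡ false) ys
        rejected []       _ = []
        rejected (y ∷ ys) e with p y in py
        ... | false = py ∷ rejected ys e
filterᵇ-singleton p (x ∷ L) e | false with filterᵇ-singleton p L e
... | L₁ , L₂ , refl , r₁ , r₂ = x ∷ L₁ , L₂ , refl , px ∷ r₁ , r₂

filterᵇ-unique : (p : X → Bool) {L : List X} {ℓ : X} → Unique L → ℓ ∈ L → p ℓ ≡ true →
  (∀ {x} → x ∈ L → p x ≡ true → x ≡ ℓ) → filterᵇ p L ≡ ℓ ∷ []
filterᵇ-unique p (ℓ∉L ∷ uL) (here refl) pℓ only =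
  trans (filterᵇ-accept p pℓ) (cong (_ ∷_) (filterᵇ-none p (All.tabulate rejected)))
  where
  rejected : ∀ {x} → x ∈ _ → p x ≡ false
  rejected {x} x∈L with p x in px
  ... | false = refl
  ... | true  = ⊥-elim (All.lookup ℓ∉L x∈L (sym (only (there x∈L) px)))
filterᵇ-unique p {y ∷ L} (y∉L ∷ uL) (there ℓ∈L) pℓ only with p y in py
... | true  = ⊥-elim (All.lookup y∉L ℓ∈L (only (here refl) py))
... | false = filterᵇ-unique p uL ℓ∈L pℓ (λ x∈L → only (there x∈L))

any-true : (p : X → Bool) {x : X} (xs : List X) → x ∈ xs → p x ≡ true → any p xs ≡ true
any-true p (y ∷ xs) (here refl) px rewrite px = refl
any-true p (y ∷ xs) (there x∈xs) px with p y
... | true  = refl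
... | false = any-true p xs x∈xs px

any-false : (p : X → Bool) (xs : List X) → All (λ x → p x ≡ false) xs → any p xs ≡ false
any-false p []       []         = refl
any-false p (x ∷ xs) (px ∷ pxs) rewrite px = any-false p xs pxs

any⇒∃ : (p : X → Bool) (xs : List X) → any p xs ≡ true → ∃ λ x → p x ≡ true
any⇒∃ p (x ∷ xs) e with p x in px
... | true  = x , px
... | false = any⇒∃ p xs e

≡ᵇ-≢ : ∀ {m n} → m ≢ n → (m ≡ᵇ n) ≡ false
≡ᵇ-≢ {m} {n} m≢n with m ≡ᵇ n in e
... | false = refl
... | true  = ⊥-elim (m≢n (≡ᵇ⇒≡′ e))

half : ∀ k → ∃ λ j → k ≡ 2 * j ⊎ k ≡ suc (2 * j)
half zero    = 0 , inj₁ refl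
half (suc k) with half k
... | j , inj₁ k≡2j  = j , inj₂ (cong suc k≡2j)
... | j , inj₂ k≡1+2j = suc j , inj₁ (trans (cong suc k≡1+2j) (sym (*-distribˡ-+ 2 1 j)))

All-upTo : ∀ {P : ℕ → Set} n → (∀ k → k < n → P k) → All P (upTo n)
All-upTo n P<n = All.tabulate (λ k∈ → P<n _ (∈-upTo⁻ k∈))

filterᵇ-concatMap : (p : Y → Bool) (f : X → List Y) (xs : List X) →
  filterᵇ p (concatMap f xs) ≡ concatMap (λ x → filterᵇ p (f x)) xs
filterᵇ-concatMap p f []       = refl
filterᵇ-concatMap p f (x ∷ xs) = trans (filter-++ _ (f x) (concatMap f xs)) (cong (filterᵇ p (f x) ++_) (filterᵇ-concatMap p f xs))

Unique-concatMap : (f : X → List Y) (key : Y → X) {xs : List X} → Unique xs →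
  (∀ x → Unique (f x)) → (∀ x {y} → y ∈ f x → key y ≡ x) → Unique (concatMap f xs)
Unique-concatMap f key []            _     _   = []
Unique-concatMap f key {x ∷ xs} (x∉xs ∷ uxs) uf keyed =
  Unique.++⁺ (uf x) (Unique-concatMap f key uxs uf keyed) disjoint
  where
  disjoint : ∀ {y} → y ∈ f x × y ∈ concatMap f xs → ⊥
  disjoint (y∈fx , y∈rest) with find (∈-concatMap⁻ f {xs = xs} y∈rest)
  ... | x′ , x′∈xs , y∈fx′ = All.lookup x∉xs x′∈xs (trans (sym (keyed x y∈fx)) (keyed x′ y∈fx′))

countSublists : (List X → Bool) → List X → ℕ
countSublists Q xs = length (filterᵇ Q (sublists xs))

countSublists-∷ : (Q : List X → Bool) (x : X) (xs : List X) →
  countSublists Q (x ∷ xs) ≡ countSublists (λ S → Q (x ∷ S)) xs + countSublists Q xs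
countSublists-∷ Q x xs = begin
  length (filterᵇ Q (map (x ∷_) (sublists xs) ++ sublists xs))
    ≡⟨ cong length (filter-++ _ (map (x ∷_) (sublists xs)) (sublists xs)) ⟩
  length (filterᵇ Q (map (x ∷_) (sublists xs)) ++ filterᵇ Q (sublists xs))
    ≡⟨ length-++ (filterᵇ Q (map (x ∷_) (sublists xs))) ⟩
  length (filterᵇ Q (map (x ∷_) (sublists xs))) + countSublists Q xs
    ≡⟨ cong (λ l → length l + countSublists Q xs) (filterᵇ-map Q (x ∷_) (sublists xs)) ⟩
  length (map (x ∷_) (filterᵇ (λ S → Q (x ∷ S)) (sublists xs))) + countSublists Q xs
    ≡⟨ cong (_+ countSublists Q xs) (length-map (x ∷_) (filterᵇ (λ S → Q (x ∷ S)) (sublists xs))) ⟩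
  countSublists (λ S → Q (x ∷ S)) xs + countSublists Q xs ∎
  where open ≡-Reasoning

countSublists-cong : (P : X → Set) (Q Q′ : List X → Bool) {xs : List X} →
  (∀ S → All P S → Q S ≡ Q′ S) → All P xs → countSublists Q xs ≡ countSublists Q′ xs
countSublists-cong P Q Q′ {[]}     Q≗Q′ []         = cong length (filterᵇ-cong Q Q′ (Q≗Q′ [] [] ∷ []))
countSublists-cong P Q Q′ {x ∷ xs} Q≗Q′ (px ∷ pxs) = begin
  countSublists Q (x ∷ xs)
    ≡⟨ countSublists-∷ Q x xs ⟩
  countSublists (λ S → Q (x ∷ S)) xs + countSublists Q xs
    ≡⟨ cong₂ _+_ (countSublists-cong P (λ S → Q (x ∷ S)) (λ S → Q′ (x ∷ S)) (λ S pS → Q≗Q′ (x ∷ S) (px ∷ pS)) pxs)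
                 (countSublists-cong P Q Q′ Q≗Q′ pxs) ⟩
  countSublists (λ S → Q′ (x ∷ S)) xs + countSublists Q′ xs
    ≡⟨ countSublists-∷ Q′ x xs ⟨
  countSublists Q′ (x ∷ xs) ∎
  where open ≡-Reasoning

countSublists-reject : (P : X → Set) (Q : List X → Bool) {xs : List X} →
  (∀ S → All P S → Q S ≡ false) → All P xs → countSublists Q xs ≡ 0
countSublists-reject P Q {xs} Q≡false pxs = begin
  countSublists Q xs              ≡⟨ countSublists-cong P Q (λ _ → false) Q≡false pxs ⟩
  countSublists (λ _ → false) xs  ≡⟨ cong length (filterᵇ-none (λ _ → false) (All.universal (λ _ → refl) (sublists xs))) ⟩
  0                               ∎
  where open ≡-Reasoning

countSublists-filterᵇ : (keep : X → Bool) (Q : List X → Bool) (xs : List X) →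
  (∀ S → Any (λ x → keep x ≡ false) S → Q S ≡ false) → countSublists Q xs ≡ countSublists Q (filterᵇ keep xs)
countSublists-filterᵇ keep Q []       _      = refl
countSublists-filterᵇ keep Q (x ∷ xs) fatal with keep x in kx
... | true = begin
  countSublists Q (x ∷ xs)
    ≡⟨ countSublists-∷ Q x xs ⟩
  countSublists (λ S → Q (x ∷ S)) xs + countSublists Q xs
    ≡⟨ cong₂ _+_ (countSublists-filterᵇ keep (λ S → Q (x ∷ S)) xs (λ S bad → fatal (x ∷ S) (there bad)))
                 (countSublists-filterᵇ keep Q xs fatal) ⟩
  countSublists (λ S → Q (x ∷ S)) (filterᵇ keep xs) + countSublists Q (filterᵇ keep xs)
    ≡⟨ countSublists-∷ Q x (filterᵇ keep xs) ⟨
  countSublists Q (x ∷ filterᵇ keep xs) ∎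
  where open ≡-Reasoning
... | false = begin
  countSublists Q (x ∷ xs)
    ≡⟨ countSublists-∷ Q x xs ⟩
  countSublists (λ S → Q (x ∷ S)) xs + countSublists Q xs
    ≡⟨ cong₂ _+_ (countSublists-reject (λ _ → ⊤) (λ S → Q (x ∷ S)) (λ S _ → fatal (x ∷ S) (here kx)) (All.universal (λ _ → tt) xs))
                 (countSublists-filterᵇ keep Q xs fatal) ⟩
  countSublists Q (filterᵇ keep xs) ∎
  where open ≡-Reasoning

sublists-map : (g : X → Y) (xs : List X) → sublists (map g xs) ≡ map (map g) (sublists xs)
sublists-map g []       = refl
sublists-map g (x ∷ xs) = begin
  map (g x ∷_) (sublists (map g xs)) ++ sublists (map g xs)
    ≡⟨ cong (λ Ss → map (g x ∷_) Ss ++ Ss) (sublists-map g xs) ⟩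
  map (g x ∷_) (map (map g) (sublists xs)) ++ map (map g) (sublists xs)
    ≡⟨ cong (_++ map (map g) (sublists xs))
            (trans (sym (map-∘ {g = map g} {f = x ∷_} (sublists xs))) (map-∘ {g = g x ∷_} {f = map g} (sublists xs))) ⟨
  map (map g) (map (x ∷_) (sublists xs)) ++ map (map g) (sublists xs)
    ≡⟨ map-++ (map g) (map (x ∷_) (sublists xs)) (sublists xs) ⟨
  map (map g) (map (x ∷_) (sublists xs) ++ sublists xs) ∎
  where open ≡-Reasoning

PermutationInvariant : (List X → Bool) → Set
PermutationInvariant Q = ∀ {S S′} → S ↭ S′ → Q S ≡ Q S′

-- Every sublist accepted by Q contains ℓ, so the accepted ones are ℓ ∷ S for S a sublist of L₁ ++ L₂.
countSublists-pull : (P : X → Set) (Q : List X → Bool) (ℓ : X) (L₁ L₂ : List X) → PermutationInvariant Q →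
  (∀ S → All P S → Q S ≡ false) → All P L₁ → All P L₂ →
  countSublists Q (L₁ ++ ℓ ∷ L₂) ≡ countSublists (λ S → Q (ℓ ∷ S)) (L₁ ++ L₂)
countSublists-pull P Q ℓ [] L₂ inv Q≡false [] pL₂ = begin
  countSublists Q (ℓ ∷ L₂)                                ≡⟨ countSublists-∷ Q ℓ L₂ ⟩
  countSublists (λ S → Q (ℓ ∷ S)) L₂ + countSublists Q L₂ ≡⟨ cong (countSublists (λ S → Q (ℓ ∷ S)) L₂ +_)
                                                                  (countSublists-reject P Q Q≡false pL₂) ⟩
  countSublists (λ S → Q (ℓ ∷ S)) L₂ + 0                  ≡⟨ +-identityʳ _ ⟩
  countSublists (λ S → Q (ℓ ∷ S)) L₂                      ∎
  where open ≡-Reasoning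
countSublists-pull P Q ℓ (x ∷ L₁) L₂ inv Q≡false (px ∷ pL₁) pL₂ = begin
  countSublists Q (x ∷ L₁ ++ ℓ ∷ L₂)
    ≡⟨ countSublists-∷ Q x (L₁ ++ ℓ ∷ L₂) ⟩
  countSublists (λ S → Q (x ∷ S)) (L₁ ++ ℓ ∷ L₂) + countSublists Q (L₁ ++ ℓ ∷ L₂)
    ≡⟨ cong₂ _+_ (countSublists-pull P (λ S → Q (x ∷ S)) ℓ L₁ L₂ (λ S↭S′ → inv (prep x S↭S′))
                                     (λ S pS → Q≡false (x ∷ S) (px ∷ pS)) pL₁ pL₂)
                 (countSublists-pull P Q ℓ L₁ L₂ inv Q≡false pL₁ pL₂) ⟩
  countSublists (λ S → Q (x ∷ ℓ ∷ S)) (L₁ ++ L₂) + countSublists (λ S → Q (ℓ ∷ S)) (L₁ ++ L₂)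
    ≡⟨ cong (_+ countSublists (λ S → Q (ℓ ∷ S)) (L₁ ++ L₂))
            (countSublists-cong (λ _ → ⊤) (λ S → Q (x ∷ ℓ ∷ S)) (λ S → Q (ℓ ∷ x ∷ S))
                                (λ S _ → inv (swap x ℓ ↭-refl)) (All.universal (λ _ → tt) (L₁ ++ L₂))) ⟩
  countSublists (λ S → Q (ℓ ∷ x ∷ S)) (L₁ ++ L₂) + countSublists (λ S → Q (ℓ ∷ S)) (L₁ ++ L₂)
    ≡⟨ countSublists-∷ (λ S → Q (ℓ ∷ S)) x (L₁ ++ L₂) ⟨
  countSublists (λ S → Q (ℓ ∷ S)) (x ∷ L₁ ++ L₂) ∎
  where open ≡-Reasoning

-- Lozenge tilings and forced lozenges

eqTri⇒≡ : ∀ {t t′} → eqTri t t′ ≡ true → t ≡ t′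
eqTri⇒≡ {s , k} {s′ , k′} e with ∧-≡true {s ≡ᵇ s′} e
... | s≡s′ , k≡k′ = cong₂ _,_ (≡ᵇ⇒≡′ s≡s′) (≡ᵇ⇒≡′ k≡k′)

eqTri-refl : ∀ t → eqTri t t ≡ true
eqTri-refl (s , k) rewrite ≡ᵇ-refl s | ≡ᵇ-refl k = refl

covers⇒≡ : ∀ {t ℓ} → covers t ℓ ≡ true → t ≡ proj₁ ℓ ⊎ t ≡ proj₂ ℓ
covers⇒≡ {t} {t₁ , t₂} c with ∨-≡true {eqTri t t₁} c
... | inj₁ e = inj₁ (eqTri⇒≡ e)
... | inj₂ e = inj₂ (eqTri⇒≡ e)

covers-proj₁ : ∀ ℓ → covers (proj₁ ℓ) ℓ ≡ true
covers-proj₁ (t₁ , t₂) rewrite eqTri-refl t₁ = refl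

covers-proj₂ : ∀ ℓ → covers (proj₂ ℓ) ℓ ≡ true
covers-proj₂ (t₁ , t₂) rewrite eqTri-refl t₂ with eqTri t₂ t₁
... | true  = refl
... | false = refl

covers-≢ : ∀ {t t₁ t₂} → t ≢ t₁ → t ≢ t₂ → covers t (t₁ , t₂) ≡ false
covers-≢ {t} {t₁} {t₂} t≢t₁ t≢t₂ with eqTri t t₁ in e₁ | eqTri t t₂ in e₂
... | true  | _     = ⊥-elim (t≢t₁ (eqTri⇒≡ e₁))
... | false | true  = ⊥-elim (t≢t₂ (eqTri⇒≡ e₂))
... | false | false = refl

∈-lozengesIn⁺ : ∀ {R x y} → x ∈ R → y ∈ R → upDownAdj x y ≡ true → (x , y) ∈ lozengesIn R
∈-lozengesIn⁺ x∈R y∈R adj = ∈-filter⁺ (T? ∘ _) (∈-cartesianProduct⁺ x∈R y∈R) (≡true⇒T adj)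

∈-lozengesIn⁻ : ∀ {R x y} → (x , y) ∈ lozengesIn R → x ∈ R × y ∈ R × upDownAdj x y ≡ true
∈-lozengesIn⁻ {R} xy∈L with ∈-filter⁻ (T? ∘ λ p → upDownAdj (proj₁ p) (proj₂ p)) {xs = cartesianProduct R R} xy∈L
... | xy∈R² , adj with ∈-cartesianProduct⁻ R R xy∈R²
...   | x∈R , y∈R = x∈R , y∈R , T⇒≡true adj

Unique-lozengesIn : ∀ {R} → Unique R → Unique (lozengesIn R)
Unique-lozengesIn uR = Unique.filter⁺ _ (Unique.cartesianProduct⁺ uR uR)

inBoth : (Tri → Bool) → Tri × Tri → Bool
inBoth p ℓ = p (proj₁ ℓ) ∧ p (proj₂ ℓ)

cartesianProduct-filterᵇ : (p : Tri → Bool) (xs ys : List Tri) →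
  cartesianProduct (filterᵇ p xs) (filterᵇ p ys) ≡ filterᵇ (inBoth p) (cartesianProduct xs ys)
cartesianProduct-filterᵇ p [] ys = refl
cartesianProduct-filterᵇ p (x ∷ xs) ys with p x in px
... | true = begin
  map (x ,_) (filterᵇ p ys) ++ cartesianProduct (filterᵇ p xs) (filterᵇ p ys)
    ≡⟨ cong₂ _++_ row (cartesianProduct-filterᵇ p xs ys) ⟩
  filterᵇ (inBoth p) (map (x ,_) ys) ++ filterᵇ (inBoth p) (cartesianProduct xs ys)
    ≡⟨ filter-++ _ (map (x ,_) ys) _ ⟨
  filterᵇ (inBoth p) (map (x ,_) ys ++ cartesianProduct xs ys) ∎
  where
  open ≡-Reasoning
  row : map (x ,_) (filterᵇ p ys) ≡ filterᵇ (inBoth p) (map (x ,_) ys)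
  row = trans (cong (map (x ,_)) (filterᵇ-cong p (λ y → p x ∧ p y) (universal ys)))
              (sym (filterᵇ-map (inBoth p) (x ,_) ys))
    where universal : ∀ zs → All (λ y → p y ≡ p x ∧ p y) zs
          universal []       = []
          universal (z ∷ zs) = cong (_∧ p z) (sym px) ∷ universal zs
... | false = begin
  cartesianProduct (filterᵇ p xs) (filterᵇ p ys)
    ≡⟨ cartesianProduct-filterᵇ p xs ys ⟩
  filterᵇ (inBoth p) (cartesianProduct xs ys)
    ≡⟨ cong (_++ filterᵇ (inBoth p) (cartesianProduct xs ys)) (filterᵇ-none (inBoth p) (rejected ys)) ⟨
  filterᵇ (inBoth p) (map (x ,_) ys) ++ filterᵇ (inBoth p) (cartesianProduct xs ys)
    ≡⟨ filter-++ _ (map (x ,_) ys) _ ⟨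
  filterᵇ (inBoth p) (map (x ,_) ys ++ cartesianProduct xs ys) ∎
  where
  open ≡-Reasoning
  rejected : ∀ zs → All (λ ℓ → inBoth p ℓ ≡ false) (map (x ,_) zs)
  rejected []       = []
  rejected (z ∷ zs) = cong (_∧ p z) px ∷ rejected zs

lozengesIn-filterᵇ : (p : Tri → Bool) (R : Region) → lozengesIn (filterᵇ p R) ≡ filterᵇ (inBoth p) (lozengesIn R)
lozengesIn-filterᵇ p R = begin
  filterᵇ adj (cartesianProduct (filterᵇ p R) (filterᵇ p R))  ≡⟨ cong (filterᵇ adj) (cartesianProduct-filterᵇ p R R) ⟩
  filterᵇ adj (filterᵇ (inBoth p) (cartesianProduct R R))     ≡⟨ filterᵇ-filterᵇ adj (inBoth p) (cartesianProduct R R) ⟩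
  filterᵇ (λ ℓ → inBoth p ℓ ∧ adj ℓ) (cartesianProduct R R)   ≡⟨ filterᵇ-cong _ _ (commute (cartesianProduct R R)) ⟩
  filterᵇ (λ ℓ → adj ℓ ∧ inBoth p ℓ) (cartesianProduct R R)   ≡⟨ filterᵇ-filterᵇ (inBoth p) adj (cartesianProduct R R) ⟨
  filterᵇ (inBoth p) (filterᵇ adj (cartesianProduct R R))     ∎
  where
  open ≡-Reasoning
  adj : Tri × Tri → Bool
  adj ℓ = upDownAdj (proj₁ ℓ) (proj₂ ℓ)
  commute : ∀ ℓs → All (λ ℓ → inBoth p ℓ ∧ adj ℓ ≡ adj ℓ ∧ inBoth p ℓ) ℓs
  commute []       = []
  commute (ℓ ∷ ℓs) = ∧-comm (inBoth p ℓ) (adj ℓ) ∷ commute ℓs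

isTiling-↭ : (R : Region) → PermutationInvariant (isTiling R)
isTiling-↭ R S↭S′ = all-cong _ _ R (λ t → cong (_≡ᵇ 1) (↭-length (filter-↭ (T? ∘ covers t) S↭S′)))

isTiling-uncovered : ∀ {R t} (S : List (Tri × Tri)) → t ∈ R → All (λ ℓ → covers t ℓ ≡ false) S → isTiling R S ≡ false
isTiling-uncovered {R} {t} S t∈R uncovered =
  all-false _ R t∈R (cong (λ l → length l ≡ᵇ 1) (filterᵇ-none (covers t) uncovered))

isTiling-overlap : ∀ {R y ℓ} (S : List (Tri × Tri)) → y ∈ R → covers y ℓ ≡ true →
  Any (λ ℓ′ → covers y ℓ′ ≡ true) S → isTiling R (ℓ ∷ S) ≡ false
isTiling-overlap {R} {y} {ℓ} S y∈R yℓ twice = all-false _ R y∈R counted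
  where
  twiceCovered : ∀ S → Any (λ ℓ′ → covers y ℓ′ ≡ true) S → (suc (length (filterᵇ (covers y) S)) ≡ᵇ 1) ≡ false
  twiceCovered (ℓ′ ∷ S) (here yℓ′) rewrite yℓ′ = refl
  twiceCovered (ℓ′ ∷ S) (there any) with covers y ℓ′
  ... | true  = refl
  ... | false = twiceCovered S any
  counted : (length (filterᵇ (covers y) (ℓ ∷ S)) ≡ᵇ 1) ≡ false
  counted rewrite yℓ = twiceCovered S twice

removeLozenge : Tri × Tri → Region → Region
removeLozenge ℓ = filterᵇ (λ t → not (covers t ℓ))

avoids : Tri × Tri → Tri × Tri → Bool
avoids ℓ = inBoth (λ t → not (covers t ℓ))

isTiling-∷ : ∀ R ℓ (S : List (Tri × Tri)) → All (λ ℓ′ → avoids ℓ ℓ′ ≡ true) S →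
  isTiling R (ℓ ∷ S) ≡ isTiling (removeLozenge ℓ R) S
isTiling-∷ R ℓ S avoid =
  all-filterᵇ (λ y → length (filterᵇ (covers y) (ℓ ∷ S)) ≡ᵇ 1) (λ y → length (filterᵇ (covers y) S) ≡ᵇ 1)
              (λ y → not (covers y ℓ)) R onℓ offℓ
  where
  uncovered : ∀ {y} → covers y ℓ ≡ true → ∀ {S} → All (λ ℓ′ → avoids ℓ ℓ′ ≡ true) S → filterᵇ (covers y) S ≡ []
  uncovered yℓ [] = refl
  uncovered {y} yℓ (_∷_ {ℓ′} av avs) with covers y ℓ′ in yℓ′
  ... | false = uncovered {y} yℓ avs
  ... | true with ∧-≡true {not (covers (proj₁ ℓ′) ℓ)} av | covers⇒≡ {y} {ℓ′} yℓ′
  ...   | a₁ , _ | inj₁ refl = ⊥-elim (true≢false (trans (sym a₁) (cong not yℓ)))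
  ...   | _ , a₂ | inj₂ refl = ⊥-elim (true≢false (trans (sym a₂) (cong not yℓ)))
  onℓ : ∀ y → not (covers y ℓ) ≡ false → (length (filterᵇ (covers y) (ℓ ∷ S)) ≡ᵇ 1) ≡ true
  onℓ y e = cong (λ l → length l ≡ᵇ 1)
    (trans (filterᵇ-accept (covers y) (not-≡false {covers y ℓ} e)) (cong (ℓ ∷_) (uncovered {y} (not-≡false e) avoid)))
  offℓ : ∀ y → not (covers y ℓ) ≡ true →
    (length (filterᵇ (covers y) (ℓ ∷ S)) ≡ᵇ 1) ≡ (length (filterᵇ (covers y) S) ≡ᵇ 1)
  offℓ y e = cong (λ l → length l ≡ᵇ 1) (filterᵇ-reject (covers y) (not-≡true {covers y ℓ} e))

covers-farther : ∀ t ℓ → proj₂ (proj₁ ℓ) < proj₂ t → proj₂ (proj₂ ℓ) < proj₂ t → covers t ℓ ≡ false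
covers-farther t (t₁ , t₂) k₁<k k₂<k =
  covers-≢ {t} {t₁} {t₂} (λ e → <⇒≢ k₁<k (sym (cong proj₂ e))) (λ e → <⇒≢ k₂<k (sym (cong proj₂ e)))

covers-nearer : ∀ t ℓ → proj₂ t < proj₂ (proj₁ ℓ) → proj₂ t < proj₂ (proj₂ ℓ) → covers t ℓ ≡ false
covers-nearer t (t₁ , t₂) k<k₁ k<k₂ = covers-≢ {t} {t₁} {t₂} (λ e → <⇒≢ k<k₁ (cong proj₂ e)) (λ e → <⇒≢ k<k₂ (cong proj₂ e))

covers-otherRow : ∀ t ℓ → proj₁ t ≢ proj₁ (proj₁ ℓ) → proj₁ t ≢ proj₁ (proj₂ ℓ) → covers t ℓ ≡ false
covers-otherRow t (t₁ , t₂) s≢s₁ s≢s₂ = covers-≢ {t} {t₁} {t₂} (λ e → s≢s₁ (cong proj₁ e)) (λ e → s≢s₂ (cong proj₁ e))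

Forced : Region → Tri × Tri → Set
Forced R ℓ = ∃ λ t → t ∈ R × filterᵇ (covers t) (lozengesIn R) ≡ ℓ ∷ []

M-removeForced : ∀ R ℓ → Forced R ℓ → M R ≡ M (removeLozenge ℓ R)
M-removeForced R ℓ (t , t∈R , onlyℓ) with filterᵇ-singleton (covers t) (lozengesIn R) onlyℓ
... | L₁ , L₂ , L≡ , r₁ , r₂ = begin
  countSublists (isTiling R) (lozengesIn R)
    ≡⟨ cong (countSublists (isTiling R)) L≡ ⟩
  countSublists (isTiling R) (L₁ ++ ℓ ∷ L₂)
    ≡⟨ countSublists-pull (λ ℓ′ → covers t ℓ′ ≡ false) (isTiling R) ℓ L₁ L₂ (isTiling-↭ R)
                          (λ S → isTiling-uncovered S t∈R) r₁ r₂ ⟩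
  countSublists (λ S → isTiling R (ℓ ∷ S)) (L₁ ++ L₂)
    ≡⟨ countSublists-filterᵇ (avoids ℓ) (λ S → isTiling R (ℓ ∷ S)) (L₁ ++ L₂) overlapping ⟩
  countSublists (λ S → isTiling R (ℓ ∷ S)) (filterᵇ (avoids ℓ) (L₁ ++ L₂))
    ≡⟨ countSublists-cong (λ ℓ′ → avoids ℓ ℓ′ ≡ true) _ (isTiling R′) (isTiling-∷ R ℓ)
                          (filterᵇ-satisfies (avoids ℓ) (L₁ ++ L₂)) ⟩
  countSublists (isTiling R′) (filterᵇ (avoids ℓ) (L₁ ++ L₂))
    ≡⟨ cong (countSublists (isTiling R′)) lozenges ⟩
  countSublists (isTiling R′) (lozengesIn R′) ∎
  where
  open ≡-Reasoning
  R′ = removeLozenge ℓ R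
  ℓ∈R : ∀ {y} → covers y ℓ ≡ true → y ∈ R
  ℓ∈R {y} yℓ with ∈-lozengesIn⁻ {R} (subst (ℓ ∈_) (sym L≡) (∈-++⁺ʳ L₁ (here refl))) | covers⇒≡ {y} {ℓ} yℓ
  ... | ℓ₁∈R , _ , _ | inj₁ refl = ℓ₁∈R
  ... | _ , ℓ₂∈R , _ | inj₂ refl = ℓ₂∈R
  clash : ∀ S → Any (λ ℓ′ → avoids ℓ ℓ′ ≡ false) S → ∃ λ y → covers y ℓ ≡ true × Any (λ ℓ′ → covers y ℓ′ ≡ true) S
  clash (ℓ′ ∷ S) (there any) with clash S any
  ... | y , yℓ , twice = y , yℓ , there twice
  clash (ℓ′ ∷ S) (here e) with ∧-≡false {not (covers (proj₁ ℓ′) ℓ)} e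
  ... | inj₁ e₁ = proj₁ ℓ′ , not-≡false e₁ , here (covers-proj₁ ℓ′)
  ... | inj₂ e₂ = proj₂ ℓ′ , not-≡false e₂ , here (covers-proj₂ ℓ′)
  overlapping : ∀ S → Any (λ ℓ′ → avoids ℓ ℓ′ ≡ false) S → isTiling R (ℓ ∷ S) ≡ false
  overlapping S any with clash S any
  ... | y , yℓ , twice = isTiling-overlap {R} {y} {ℓ} S (ℓ∈R yℓ) yℓ twice
  lozenges : filterᵇ (avoids ℓ) (L₁ ++ L₂) ≡ lozengesIn R′
  lozenges = begin
    filterᵇ (avoids ℓ) (L₁ ++ L₂)                  ≡⟨ filter-++ _ L₁ L₂ ⟩
    filterᵇ (avoids ℓ) L₁ ++ filterᵇ (avoids ℓ) L₂ ≡⟨ cong (filterᵇ (avoids ℓ) L₁ ++_) (filterᵇ-reject (avoids ℓ) {ℓ} {L₂} ℓ-overlaps) ⟨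
    filterᵇ (avoids ℓ) L₁ ++ filterᵇ (avoids ℓ) (ℓ ∷ L₂) ≡⟨ filter-++ _ L₁ (ℓ ∷ L₂) ⟨
    filterᵇ (avoids ℓ) (L₁ ++ ℓ ∷ L₂)              ≡⟨ cong (filterᵇ (avoids ℓ)) L≡ ⟨
    filterᵇ (avoids ℓ) (lozengesIn R)              ≡⟨ lozengesIn-filterᵇ _ R ⟨
    lozengesIn R′                                  ∎
    where ℓ-overlaps : avoids ℓ ℓ ≡ false
          ℓ-overlaps rewrite covers-proj₁ ℓ = refl

isUp-even : ∀ {s k} q → s + k ≡ q * 2 → isUp (s , k) ≡ true
isUp-even q e = cong (_≡ᵇ 0) (trans (cong (_% 2) e) (m*n%n≡0 q 2))

isUp-odd : ∀ {s k} q → s + k ≡ 1 + q * 2 → isUp (s , k) ≡ false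
isUp-odd q e = cong (_≡ᵇ 0) (trans (cong (_% 2) e) ([m+kn]%n≡m%n 1 q 2))

upDownAdj-east : ∀ {s k} → isUp (s , k) ≡ true → upDownAdj (s , k) (s , suc k) ≡ true
upDownAdj-east {s} {k} up rewrite up | ≡ᵇ-refl s | ≡ᵇ-refl k = refl

upDownAdj-west : ∀ {s k} → isUp (s , suc k) ≡ true → upDownAdj (s , suc k) (s , k) ≡ true
upDownAdj-west {s} {k} up rewrite up | ≡ᵇ-refl s | ≡ᵇ-refl k | ∨-zeroʳ (k ≡ᵇ suc (suc k)) = refl

-- k grows westwards, so the east neighbour of (s , suc k) is (s , k).
data UpNeighbour : Tri → Tri → Set where
  east  : ∀ {s k} → UpNeighbour (s , k) (s , suc k)
  west  : ∀ {s k} → UpNeighbour (s , suc k) (s , k)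
  above : ∀ {s k} → UpNeighbour (s , k) (suc s , k)

upNeighbour : ∀ x t → upDownAdj x t ≡ true → UpNeighbour x t
upNeighbour (s , k) (s′ , k′) adj with ∨-≡true (proj₂ (∧-≡true {isUp (s , k)} adj))
... | inj₂ below with ∧-≡true {s′ ≡ᵇ suc s} below
...   | e₁ , e₂ with ≡ᵇ⇒≡′ {s′} {suc s} e₁ | ≡ᵇ⇒≡′ {k′} {k} e₂
...     | refl | refl = above
upNeighbour (s , k) (s′ , k′) adj | inj₁ sameRow with ∧-≡true {s′ ≡ᵇ s} sameRow
... | e₁ , e₂ with ≡ᵇ⇒≡′ {s′} {s} e₁ | ∨-≡true {k′ ≡ᵇ suc k} e₂
...   | refl | inj₁ e₃ with ≡ᵇ⇒≡′ {k′} {suc k} e₃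
...     | refl = east
upNeighbour (s , k) (s′ , k′) adj | inj₁ sameRow | e₁ , e₂ | refl | inj₂ e₃ with ≡ᵇ⇒≡′ {k} {suc k′} e₃
...     | refl = west

upDownAdj⇒isUp : ∀ x y → upDownAdj x y ≡ true → isUp x ≡ true
upDownAdj⇒isUp x y adj = proj₁ (∧-≡true {isUp x} adj)

forcedBy : ∀ {R t x} → Unique R → t ∈ R → isUp t ≡ false → x ∈ R → upDownAdj x t ≡ true →
  (∀ y → y ∈ R → upDownAdj y t ≡ true → y ≡ x) → Forced R (x , t)
forcedBy {R} {t} {x} uR t∈R t-down x∈R adj neighbour =
  t , t∈R , filterᵇ-unique (covers t) (Unique-lozengesIn uR) (∈-lozengesIn⁺ x∈R t∈R adj) (covers-proj₂ (x , t)) only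
  where
  only : ∀ {ℓ} → ℓ ∈ lozengesIn R → covers t ℓ ≡ true → ℓ ≡ (x , t)
  only {y , z} ℓ∈L tℓ with ∈-lozengesIn⁻ {R} ℓ∈L | covers⇒≡ {t} {y , z} tℓ
  ... | _ , _ , adj′ | inj₁ refl = ⊥-elim (true≢false (trans (sym (upDownAdj⇒isUp y z adj′)) t-down))
  ... | y∈R , _ , adj′ | inj₂ refl = cong (_, t) (neighbour y y∈R adj′)

outside : List (Tri × Tri) → Tri → Bool
outside []       t = true
outside (ℓ ∷ ℓs) t = outside ℓs t ∧ not (covers t ℓ)

removeLozenges : List (Tri × Tri) → Region → Region
removeLozenges ℓs = filterᵇ (outside ℓs)

outside-true : ∀ {t} ℓs → All (λ ℓ → covers t ℓ ≡ false) ℓs → outside ℓs t ≡ true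
outside-true []       []           = refl
outside-true {t} (ℓ ∷ ℓs) (tℓ ∷ rest) rewrite tℓ | outside-true {t} ℓs rest = refl

outside-false : ∀ {t ℓ} ℓs → ℓ ∈ ℓs → covers t ℓ ≡ true → outside ℓs t ≡ false
outside-false {t} (ℓ ∷ ℓs) (here refl) tℓ rewrite tℓ = ∧-zeroʳ (outside ℓs t)
outside-false {t} (ℓ′ ∷ ℓs) (there ℓ∈ℓs) tℓ rewrite outside-false {t} ℓs ℓ∈ℓs tℓ = refl

-- The list is removed from its end: each lozenge is forced once those after it are gone.
ForcedSequence : Region → List (Tri × Tri) → Set
ForcedSequence R []       = ⊤
ForcedSequence R (ℓ ∷ ℓs) = ForcedSequence R ℓs × Forced (removeLozenges ℓs R) ℓ

M-removeForcedSequence : ∀ R ℓs → ForcedSequence R ℓs → M R ≡ M (removeLozenges ℓs R)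
M-removeForcedSequence R []       _ = cong M (sym (filter-all (T? ∘ outside []) (All.universal (λ _ → tt) R)))
M-removeForcedSequence R (ℓ ∷ ℓs) (earlier , forced) = begin
  M R                                         ≡⟨ M-removeForcedSequence R ℓs earlier ⟩
  M (removeLozenges ℓs R)                     ≡⟨ M-removeForced _ ℓ forced ⟩
  M (removeLozenge ℓ (removeLozenges ℓs R))   ≡⟨ cong M (filterᵇ-filterᵇ _ (outside ℓs) R) ⟩
  M (removeLozenges (ℓ ∷ ℓs) R)               ∎
  where open ≡-Reasoning

Unique-removeLozenges : ∀ {R} ℓs → Unique R → Unique (removeLozenges ℓs R)
Unique-removeLozenges ℓs = Unique.filter⁺ (T? ∘ outside ℓs)

down₂ : Tri → Tri
down₂ (s , k) = (suc (suc s) , k)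

down₂ˡ : Tri × Tri → Tri × Tri
down₂ˡ (x , y) = (down₂ x , down₂ y)

cartesianProduct-down₂ : ∀ xs ys → cartesianProduct (map down₂ xs) (map down₂ ys) ≡ map down₂ˡ (cartesianProduct xs ys)
cartesianProduct-down₂ []       ys = refl
cartesianProduct-down₂ (x ∷ xs) ys = begin
  map (down₂ x ,_) (map down₂ ys) ++ cartesianProduct (map down₂ xs) (map down₂ ys)
    ≡⟨ cong₂ _++_ (trans (sym (map-∘ ys)) (map-∘ ys)) (cartesianProduct-down₂ xs ys) ⟩
  map down₂ˡ (map (x ,_) ys) ++ map down₂ˡ (cartesianProduct xs ys)
    ≡⟨ map-++ down₂ˡ (map (x ,_) ys) _ ⟨
  map down₂ˡ (map (x ,_) ys ++ cartesianProduct xs ys) ∎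
  where open ≡-Reasoning

isUp-down₂ : ∀ t → isUp (down₂ t) ≡ isUp t
isUp-down₂ (s , k) = cong (_≡ᵇ 0) (trans (cong (_% 2) (+-comm 2 (s + k))) ([m+kn]%n≡m%n (s + k) 1 2))

upDownAdj-down₂ : ∀ x y → upDownAdj (down₂ x) (down₂ y) ≡ upDownAdj x y
upDownAdj-down₂ (s , k) (s′ , k′) rewrite isUp-down₂ (s , k) = refl

lozengesIn-down₂ : ∀ R → lozengesIn (map down₂ R) ≡ map down₂ˡ (lozengesIn R)
lozengesIn-down₂ R = begin
  filterᵇ adj (cartesianProduct (map down₂ R) (map down₂ R))  ≡⟨ cong (filterᵇ adj) (cartesianProduct-down₂ R R) ⟩
  filterᵇ adj (map down₂ˡ (cartesianProduct R R))             ≡⟨ filterᵇ-map adj down₂ˡ (cartesianProduct R R) ⟩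
  map down₂ˡ (filterᵇ (λ ℓ → adj (down₂ˡ ℓ)) (cartesianProduct R R))
    ≡⟨ cong (map down₂ˡ) (filterᵇ-cong (λ ℓ → adj (down₂ˡ ℓ)) adj (invariant (cartesianProduct R R))) ⟩
  map down₂ˡ (filterᵇ adj (cartesianProduct R R))             ∎
  where
  open ≡-Reasoning
  adj : Tri × Tri → Bool
  adj ℓ = upDownAdj (proj₁ ℓ) (proj₂ ℓ)
  invariant : ∀ ℓs → All (λ ℓ → adj (down₂ˡ ℓ) ≡ adj ℓ) ℓs
  invariant []            = []
  invariant ((x , y) ∷ ℓs) = upDownAdj-down₂ x y ∷ invariant ℓs

isTiling-down₂ : ∀ R S → isTiling (map down₂ R) (map down₂ˡ S) ≡ isTiling R S
isTiling-down₂ R S = trans (cong and (sym (map-∘ R))) (all-cong _ (λ t → length (filterᵇ (covers t) S) ≡ᵇ 1) R coverCount)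
  where
  coverCount : ∀ t → (length (filterᵇ (covers (down₂ t)) (map down₂ˡ S)) ≡ᵇ 1) ≡ (length (filterᵇ (covers t) S) ≡ᵇ 1)
  coverCount t = cong (_≡ᵇ 1) (trans (cong length (filterᵇ-map (covers (down₂ t)) down₂ˡ S))
                                     (length-map down₂ˡ (filterᵇ (covers t) S)))

M-down₂ : ∀ R → M (map down₂ R) ≡ M R
M-down₂ R = begin
  length (filterᵇ (isTiling (map down₂ R)) (sublists (lozengesIn (map down₂ R))))
    ≡⟨ cong (λ L → length (filterᵇ (isTiling (map down₂ R)) L))
            (trans (cong sublists (lozengesIn-down₂ R)) (sublists-map down₂ˡ (lozengesIn R))) ⟩
  length (filterᵇ (isTiling (map down₂ R)) (map (map down₂ˡ) (sublists (lozengesIn R))))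
    ≡⟨ cong length (filterᵇ-map (isTiling (map down₂ R)) (map down₂ˡ) Ss) ⟩
  length (map (map down₂ˡ) (filterᵇ (λ S → isTiling (map down₂ R) (map down₂ˡ S)) (sublists (lozengesIn R))))
    ≡⟨ length-map (map down₂ˡ) (filterᵇ (λ S → isTiling (map down₂ R) (map down₂ˡ S)) Ss) ⟩
  length (filterᵇ (λ S → isTiling (map down₂ R) (map down₂ˡ S)) (sublists (lozengesIn R)))
    ≡⟨ cong length (filterᵇ-cong (λ S → isTiling (map down₂ R) (map down₂ˡ S)) (isTiling R) (All.universal (isTiling-down₂ R) Ss)) ⟩
  M R ∎
  where
  open ≡-Reasoning
  Ss = sublists (lozengesIn R)

row : (ℕ → ℕ) → ℕ → List Tri
row h s = map (λ k → (s , suc k)) (upTo (h s))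

rows : ℕ → (ℕ → ℕ) → Region
rows T h = concatMap (row h) (upTo T)

∈-rows⁺ : ∀ {T h s k} → s < T → k < h s → (s , suc k) ∈ rows T h
∈-rows⁺ {h = h} s<T k<h = ∈-concatMap⁺ (row h) (lose (∈-upTo⁺ s<T) (∈-map⁺ _ (∈-upTo⁺ k<h)))

∈-rows⁻ : ∀ {T h s k} → (s , k) ∈ rows T h → s < T × ∃ λ k′ → k ≡ suc k′ × k′ < h s
∈-rows⁻ {T} {h} t∈ with find (∈-concatMap⁻ (row h) {xs = upTo T} t∈)
... | s′ , s′∈ , t∈row with ∈-map⁻ _ t∈row
...   | k′ , k′∈ , refl = ∈-upTo⁻ s′∈ , k′ , refl , ∈-upTo⁻ k′∈

Unique-rows : ∀ T h → Unique (rows T h)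
Unique-rows T h = Unique-concatMap (row h) proj₁ (Unique.upTo⁺ T)
  (λ s → Unique.map⁺ (λ { refl → refl }) (Unique.upTo⁺ (h s)))
  (λ s y∈row → case ∈-map⁻ _ y∈row of λ { (_ , _ , refl) → refl })

Unique-V : ∀ a b n w → Unique (V a b n w)
Unique-V a b n w = Unique.filter⁺ _ (Unique-rows (2 * b + 2 * n) (hexBound a b n))

isRemoved-true : ∀ a n w {s k} (i : Fin n) → suc s ≡ w i → k ≡ 2 * a + s → isRemoved a n w (s , k) ≡ true
isRemoved-true a n w {s} i s≡wi refl
  rewrite any-true (λ j → suc s ≡ᵇ w j) (allFin n) (∈-allFin i) (subst (λ v → (suc s ≡ᵇ v) ≡ true) s≡wi (≡ᵇ-refl (suc s)))
  = ≡ᵇ-refl (2 * a + s)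

isRemoved-unlisted : ∀ a n w {s k} → (∀ i → suc s ≢ w i) → isRemoved a n w (s , k) ≡ false
isRemoved-unlisted a n w {s} s∉w
  rewrite any-false (λ j → suc s ≡ᵇ w j) (allFin n) (All.universal (λ i → ≡ᵇ-≢ (s∉w i)) (allFin n)) = refl

isRemoved-inner : ∀ a n w {s k} → k ≢ 2 * a + s → isRemoved a n w (s , k) ≡ false
isRemoved-inner a n w {s} k≢ rewrite ≡ᵇ-≢ k≢ = ∧-zeroʳ _

isRemoved⇒ : ∀ a n w {s k} → isRemoved a n w (s , k) ≡ true → (∃ λ i → suc s ≡ w i) × k ≡ 2 * a + s
isRemoved⇒ a n w {s} e with ∧-≡true {any (λ j → suc s ≡ᵇ w j) (allFin n)} e
... | listed , border with any⇒∃ (λ j → suc s ≡ᵇ w j) (allFin n) listed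
...   | i , s≡wi = (i , ≡ᵇ⇒≡′ s≡wi) , ≡ᵇ⇒≡′ border

∈-V⁺ : ∀ a b n w {s k} → s < 2 * b + 2 * n → k < hexBound a b n s → isRemoved a n w (s , suc k) ≡ false →
  (s , suc k) ∈ V a b n w
∈-V⁺ a b n w s<T k<h kept = ∈-filter⁺ _ (∈-rows⁺ s<T k<h) (≡true⇒T (cong not kept))

∈-V⁻ : ∀ a b n w {s k} → (s , k) ∈ V a b n w →
  s < 2 * b + 2 * n × (∃ λ k′ → k ≡ suc k′ × k′ < hexBound a b n s) × isRemoved a n w (s , k) ≡ false
∈-V⁻ a b n w t∈V with ∈-filter⁻ (T? ∘ not ∘ isRemoved a n w) {xs = rows (2 * b + 2 * n) (hexBound a b n)} t∈V
... | t∈rows , kept with ∈-rows⁻ {2 * b + 2 * n} {hexBound a b n} t∈rows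
...   | s<T , inRow = s<T , inRow , not-≡true (T⇒≡true kept)

filterᵇ-row : (p q : Tri → Bool) (s : ℕ) {h h′ : ℕ} → h′ ≤ h →
  (∀ k → k < h′ → p (s , suc k) ≡ q (s , suc k)) → (∀ k → h′ ≤ k → k < h → p (s , suc k) ≡ false) →
  filterᵇ p (map (λ k → (s , suc k)) (upTo h)) ≡ filterᵇ q (map (λ k → (s , suc k)) (upTo h′))
filterᵇ-row p q s {h} {h′} h′≤h agree surplus with m≤n⇒m<n∨m≡n h′≤h
... | inj₂ refl = begin
  filterᵇ p (map mk (upTo h))          ≡⟨ filterᵇ-map p mk (upTo h) ⟩
  map mk (filterᵇ (p ∘ mk) (upTo h))   ≡⟨ cong (map mk) (filterᵇ-cong (p ∘ mk) (q ∘ mk) (All-upTo h agree)) ⟩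
  map mk (filterᵇ (q ∘ mk) (upTo h))   ≡⟨ filterᵇ-map q mk (upTo h) ⟨
  filterᵇ q (map mk (upTo h))          ∎
  where
  open ≡-Reasoning
  mk = λ k → (s , suc k)
filterᵇ-row p q s {suc h₀} {h′} h′≤h agree surplus | inj₁ (s≤s h′≤h₀) = begin
  filterᵇ p (map mk (upTo (suc h₀)))                    ≡⟨ cong (filterᵇ p ∘ map mk) (upTo-∷ʳ h₀) ⟨
  filterᵇ p (map mk (upTo h₀ ++ h₀ ∷ []))              ≡⟨ cong (filterᵇ p) (map-++ mk (upTo h₀) (h₀ ∷ [])) ⟩
  filterᵇ p (map mk (upTo h₀) ++ mk h₀ ∷ [])           ≡⟨ filter-++ _ (map mk (upTo h₀)) (mk h₀ ∷ []) ⟩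
  filterᵇ p (map mk (upTo h₀)) ++ filterᵇ p (mk h₀ ∷ [])
    ≡⟨ cong₂ _++_ (filterᵇ-row p q s h′≤h₀ agree (λ k h′≤k k<h₀ → surplus k h′≤k (m≤n⇒m≤1+n k<h₀)))
                  (filterᵇ-reject p (surplus h₀ h′≤h₀ ≤-refl)) ⟩
  filterᵇ q (map mk (upTo h′)) ++ []                    ≡⟨ ++-identityʳ _ ⟩
  filterᵇ q (map mk (upTo h′))                          ∎
  where
  open ≡-Reasoning
  mk = λ k → (s , suc k)

filterᵇ-rows : (p q : Tri → Bool) (T : ℕ) (h h′ : ℕ → ℕ) → (∀ s → s < T → filterᵇ p (row h s) ≡ filterᵇ q (row h′ s)) →
  filterᵇ p (rows T h) ≡ filterᵇ q (rows T h′)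
filterᵇ-rows p q T h h′ rowwise = begin
  filterᵇ p (rows T h)                              ≡⟨ filterᵇ-concatMap p (row h) (upTo T) ⟩
  concatMap (λ s → filterᵇ p (row h s)) (upTo T)    ≡⟨ cong concat (map-cong-local (All-upTo T rowwise)) ⟩
  concatMap (λ s → filterᵇ q (row h′ s)) (upTo T)   ≡⟨ filterᵇ-concatMap q (row h′) (upTo T) ⟨
  filterᵇ q (rows T h′)                             ∎
  where open ≡-Reasoning

hexBound-upper : ∀ a b n s → suc s ≤ b + 2 * n → hexBound a b n s ≡ 2 * a + s
hexBound-upper a b n s s<N with m≤n⇒∃[o]m+o≡n s<N
... | d , N≡ = m≤n⇒m⊓n≡m (subst (2 * a + s ≤_) (sym eastEnd) (m≤m+n (2 * a + s) (suc (2 * d))))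
  where
  open ≡-Reasoning
  double : ∀ a b n → 2 * a + 2 * b + 4 * n ≡ 2 * a + 2 * (b + 2 * n)
  double = solve-∀
  regroup : ∀ a s d → 2 * a + 2 * (suc s + d) ≡ 2 * a + s + suc (2 * d) + suc s
  regroup = solve-∀
  eastEnd : 2 * a + 2 * b + 4 * n ∸ suc s ≡ 2 * a + s + suc (2 * d)
  eastEnd = begin
    2 * a + 2 * b + 4 * n ∸ suc s              ≡⟨ cong (_∸ suc s) (trans (double a b n) (cong (λ N → 2 * a + 2 * N) (sym N≡))) ⟩
    2 * a + 2 * (suc s + d) ∸ suc s            ≡⟨ cong (_∸ suc s) (regroup a s d) ⟩
    2 * a + s + suc (2 * d) + suc s ∸ suc s    ≡⟨ m+n∸n≡m _ (suc s) ⟩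
    2 * a + s + suc (2 * d)                    ∎

hexBound-lower : ∀ a b n j r → b ≡ j + suc r → hexBound a b n (b + 2 * n + j) ≡ 2 * a + 2 * n + r
hexBound-lower a b n j r refl =
  trans (cong ((2 * a + (b + 2 * n + j)) ⊓_) westEnd) (m≥n⇒m⊓n≡n (subst (2 * a + 2 * n + r ≤_) (sym (wider a n j r)) (m≤m+n _ _)))
  where
  regroup : ∀ a n j r → 2 * a + 2 * (j + suc r) + 4 * n ≡ 2 * a + 2 * n + r + suc (j + suc r + 2 * n + j)
  regroup = solve-∀
  wider : ∀ a n j r → 2 * a + (j + suc r + 2 * n + j) ≡ 2 * a + 2 * n + r + suc (j + j)
  wider = solve-∀
  westEnd : 2 * a + 2 * b + 4 * n ∸ suc (b + 2 * n + j) ≡ 2 * a + 2 * n + r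
  westEnd = trans (cong (_∸ suc (b + 2 * n + j)) (regroup a n j r)) (m+n∸n≡m _ (suc (b + 2 * n + j)))

hexBound-suc-suc : ∀ a b n s → hexBound a b (suc n) (suc (suc s)) ≡ hexBound (suc a) b n s
hexBound-suc-suc a b n s = cong₂ _⊓_ (shiftWest a s) (cong (_∸ suc (suc (suc s))) (shiftEast a b n))
  where
  shiftWest : ∀ a s → 2 * a + suc (suc s) ≡ 2 * suc a + s
  shiftWest = solve-∀
  shiftEast : ∀ a b n → 2 * a + 2 * b + 4 * suc n ≡ suc (suc (2 * suc a + 2 * b + 4 * n))
  shiftEast = solve-∀

isRemoved-init : ∀ a m (u : Fin (suc m) → ℕ) {s k} → suc s ≢ u (fromℕ m) →
  isRemoved a (suc m) u (s , k) ≡ isRemoved a m (λ i → u (inject₁ i)) (s , k)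
isRemoved-init a m u {s} {k} s≢last = Bool-ext forward backward
  where
  forward : isRemoved a (suc m) u (s , k) ≡ true → isRemoved a m (λ i → u (inject₁ i)) (s , k) ≡ true
  forward e with isRemoved⇒ a (suc m) u {s} {k} e
  ... | (i , s≡ui) , border with m ℕ.≟ toℕ i
  ...   | yes m≡i = ⊥-elim (s≢last (trans s≡ui (cong u (toℕ-injective (trans (sym m≡i) (sym (toℕ-fromℕ m)))))))
  ...   | no m≢i  = isRemoved-true a m (λ i → u (inject₁ i)) {s} {k} (lower₁ i m≢i) (trans s≡ui (cong u (sym (inject₁-lower₁ i m≢i)))) border
  backward : isRemoved a m (λ i → u (inject₁ i)) (s , k) ≡ true → isRemoved a (suc m) u (s , k) ≡ true
  backward e with isRemoved⇒ a m (λ i → u (inject₁ i)) {s} {k} e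
  ... | (i , s≡ui) , border = isRemoved-true a (suc m) u {s} {k} (inject₁ i) s≡ui border

filterᵇ-row-down₂ : (p q : Tri → Bool) (s : ℕ) {h h′ : ℕ} → h ≡ h′ →
  (∀ k → k < h′ → p (down₂ (s , suc k)) ≡ q (s , suc k)) →
  filterᵇ p (map (λ k → (suc (suc s) , suc k)) (upTo h)) ≡ map down₂ (filterᵇ q (map (λ k → (s , suc k)) (upTo h′)))
filterᵇ-row-down₂ p q s {h} refl agree = begin
  filterᵇ p (map (down₂ ∘ mk) (upTo h))          ≡⟨ cong (filterᵇ p) (map-∘ (upTo h)) ⟩
  filterᵇ p (map down₂ (map mk (upTo h)))        ≡⟨ filterᵇ-map p down₂ (map mk (upTo h)) ⟩
  map down₂ (filterᵇ (p ∘ down₂) (map mk (upTo h)))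
    ≡⟨ cong (map down₂) (filterᵇ-row (p ∘ down₂) q s ≤-refl agree (λ k h≤k k<h → ⊥-elim (<⇒≱ k<h h≤k))) ⟩
  map down₂ (filterᵇ q (map mk (upTo h)))        ∎
  where
  open ≡-Reasoning
  mk = λ k → (s , suc k)

filterᵇ-rows-down₂ : (p q : Tri → Bool) (T : ℕ) (h h′ : ℕ → ℕ) →
  filterᵇ p (row h 0) ≡ [] → filterᵇ p (row h 1) ≡ [] →
  (∀ s → s < T → filterᵇ p (row h (suc (suc s))) ≡ map down₂ (filterᵇ q (row h′ s))) →
  filterᵇ p (rows (suc (suc T)) h) ≡ map down₂ (filterᵇ q (rows T h′))
filterᵇ-rows-down₂ p q T h h′ row₀ row₁ rowShifted = begin
  filterᵇ p (row h 0 ++ row h 1 ++ concatMap (row h) (applyUpTo (ℕ.suc ∘ ℕ.suc) T))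
    ≡⟨ filter-++ _ (row h 0) _ ⟩
  filterᵇ p (row h 0) ++ filterᵇ p (row h 1 ++ concatMap (row h) (applyUpTo (ℕ.suc ∘ ℕ.suc) T))
    ≡⟨ cong₂ _++_ row₀ (trans (filter-++ _ (row h 1) _) (cong (_++ filterᵇ p (concatMap (row h) (applyUpTo (ℕ.suc ∘ ℕ.suc) T))) row₁)) ⟩
  filterᵇ p (concatMap (row h) (applyUpTo (ℕ.suc ∘ ℕ.suc) T))
    ≡⟨ cong (filterᵇ p ∘ concat) (trans (map-applyUpTo (ℕ.suc ∘ ℕ.suc) (row h) T) (sym (map-upTo (row h ∘ ℕ.suc ∘ ℕ.suc) T))) ⟩
  filterᵇ p (concatMap (row h ∘ ℕ.suc ∘ ℕ.suc) (upTo T))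
    ≡⟨ filterᵇ-concatMap p (row h ∘ ℕ.suc ∘ ℕ.suc) (upTo T) ⟩
  concatMap (λ s → filterᵇ p (row h (suc (suc s)))) (upTo T)
    ≡⟨ cong concat (map-cong-local (All-upTo T rowShifted)) ⟩
  concatMap (λ s → map down₂ (filterᵇ q (row h′ s))) (upTo T)
    ≡⟨ map-concatMap down₂ (λ s → filterᵇ q (row h′ s)) (upTo T) ⟨
  map down₂ (concatMap (λ s → filterᵇ q (row h′ s)) (upTo T))
    ≡⟨ cong (map down₂) (filterᵇ-concatMap q (row h′) (upTo T)) ⟨
  map down₂ (filterᵇ q (rows T h′)) ∎
  where open ≡-Reasoning

-- Last entry b + 2n: the western lozenges of the bottom rows are forced

module LastEntryMax (a b m : ℕ) (u : Fin (suc m) → ℕ)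
  (u≤N : ∀ i → u i ≤ b + 2 * suc m) (u-last : u (fromℕ m) ≡ b + 2 * suc m) where

  N : ℕ
  N = b + 2 * suc m

  u′ : Fin m → ℕ
  u′ i = u (inject₁ i)

  Vₒ : Region
  Vₒ = V a b (suc m) u

  -- Row N + j of V a (suc b) m u′ has w j triangles; in Vₒ it has two more, forming ℓ j.
  w : ℕ → ℕ
  w j = 2 * a + 2 * m + (b ∸ suc j)

  x t : ℕ → Tri
  x j = (N + j , suc (w j))
  t j = (N + j , suc (suc (w j)))

  ℓ : ℕ → Tri × Tri
  ℓ j = (x j , t j)

  ℓs : ℕ → List (Tri × Tri)
  ℓs zero    = []
  ℓs (suc j) = ℓ j ∷ ℓs j

  w-def : ∀ {j r} → suc j + r ≡ b → w j ≡ 2 * a + 2 * m + r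
  w-def {j} {r} e = cong (2 * a + 2 * m +_) (trans (cong (_∸ suc j) (sym e)) (m+n∸m≡n (suc j) r))

  width-old : ∀ {j r} → suc j + r ≡ b → hexBound a b (suc m) (N + j) ≡ suc (suc (w j))
  width-old {j} {r} e = begin
    hexBound a b (suc m) (N + j)   ≡⟨ hexBound-lower a b (suc m) j r (trans (sym e) (sym (+-suc j r))) ⟩
    2 * a + 2 * suc m + r          ≡⟨ regroup a m r ⟩
    suc (suc (2 * a + 2 * m + r))  ≡⟨ cong (ℕ.suc ∘ ℕ.suc) (w-def e) ⟨
    suc (suc (w j))                ∎
    where
    open ≡-Reasoning
    regroup : ∀ a m r → 2 * a + 2 * suc m + r ≡ suc (suc (2 * a + 2 * m + r))
    regroup = solve-∀

  width-new : ∀ {j r} → suc j + r ≡ b → hexBound a (suc b) m (N + j) ≡ w j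
  width-new {j} {r} e = begin
    hexBound a (suc b) m (N + j)               ≡⟨ cong (hexBound a (suc b) m) (reindex b m j) ⟩
    hexBound a (suc b) m (suc b + 2 * m + suc j) ≡⟨ hexBound-lower a (suc b) m (suc j) r (cong suc (trans (sym e) (sym (+-suc j r)))) ⟩
    2 * a + 2 * m + r                          ≡⟨ w-def e ⟨
    w j                                        ∎
    where
    open ≡-Reasoning
    reindex : ∀ b m j → b + 2 * suc m + j ≡ suc b + 2 * m + suc j
    reindex = solve-∀

  unlisted : ∀ {s k} → N ≤ s → isRemoved a (suc m) u (s , k) ≡ false
  unlisted {s} {k} N≤s = isRemoved-unlisted a (suc m) u {s} {k} (λ i s≡ui → <⇒≢ (s≤s (≤-trans (u≤N i) N≤s)) (sym s≡ui))

  unlisted′ : ∀ {s k} → N ≤ s → isRemoved a m u′ (s , k) ≡ false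
  unlisted′ {s} {k} N≤s = isRemoved-unlisted a m u′ {s} {k} (λ i s≡ui → <⇒≢ (s≤s (≤-trans (u≤N (inject₁ i)) N≤s)) (sym s≡ui))

  outside-ℓs : ∀ J {y} → (∀ i → i < J → covers y (ℓ i) ≡ false) → outside (ℓs J) y ≡ true
  outside-ℓs J {y} avoid = outside-true (ℓs J) (avoided J avoid)
    where
    avoided : ∀ J → (∀ i → i < J → covers y (ℓ i) ≡ false) → All (λ ℓ′ → covers y ℓ′ ≡ false) (ℓs J)
    avoided zero    _     = []
    avoided (suc J) avoid = avoid J ≤-refl ∷ avoided J (λ i i<J → avoid i (m<n⇒m<1+n i<J))

  ∈-ℓs : ∀ {i J} → i < J → ℓ i ∈ ℓs J
  ∈-ℓs {i} {suc J} i<1+J with m≤n⇒m<n∨m≡n (≤-pred i<1+J)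
  ... | inj₁ i<J  = there (∈-ℓs i<J)
  ... | inj₂ refl = here refl

  rows≡ : 2 * b + 2 * suc m ≡ N + b
  rows≡ = regroup b m
    where regroup : ∀ b m → 2 * b + 2 * suc m ≡ b + 2 * suc m + b
          regroup = solve-∀

  parity : ∀ {j r} → suc j + r ≡ b → ∀ c → N + j + (c + w j) ≡ c + 1 + (j + r + 2 * m + a + 1) * 2
  parity {j} {r} e c = begin
    N + j + (c + w j)                                       ≡⟨ cong₂ (λ b′ w′ → b′ + 2 * suc m + j + (c + w′)) (sym e) (w-def e) ⟩
    suc j + r + 2 * suc m + j + (c + (2 * a + 2 * m + r))   ≡⟨ regroup a m j r c ⟩
    c + 1 + (j + r + 2 * m + a + 1) * 2                     ∎
    where
    open ≡-Reasoning
    regroup : ∀ a m j r c → suc j + r + 2 * suc m + j + (c + (2 * a + 2 * m + r)) ≡ c + 1 + (j + r + 2 * m + a + 1) * 2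
    regroup = solve-∀

  -- The up-neighbour of t j in the row above is x (j - 1), or for j = 0 the triangle removed since u (fromℕ m) ≡ N.
  aboveRemoved : ∀ j {s k} → suc s ≡ N + j → k ≡ suc (suc (w j)) → j < b →
    (s , k) ∈ Vₒ → outside (ℓs j) (s , k) ≡ true → ⊥
  aboveRemoved zero {s} {k} s≡ k≡ 0<b y∈V _ with m≤n⇒∃[o]m+o≡n 0<b
  ... | r , e = true≢false (trans (sym removed) (proj₂ (proj₂ (∈-V⁻ a b (suc m) u y∈V))))
    where
    open ≡-Reasoning
    regroup : ∀ a m r → suc (suc (suc (2 * a + 2 * m + r))) ≡ 2 * a + (suc r + 2 * suc m + 0)
    regroup = solve-∀
    k≡2a+s : k ≡ 2 * a + s
    k≡2a+s = suc-injective (begin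
      suc k                                ≡⟨ cong suc (trans k≡ (cong (ℕ.suc ∘ ℕ.suc) (w-def e))) ⟩
      suc (suc (suc (2 * a + 2 * m + r)))  ≡⟨ regroup a m r ⟩
      2 * a + (suc r + 2 * suc m + 0)      ≡⟨ cong (λ b′ → 2 * a + (b′ + 2 * suc m + 0)) e ⟩
      2 * a + (N + 0)                      ≡⟨ cong (2 * a +_) s≡ ⟨
      2 * a + suc s                        ≡⟨ +-suc (2 * a) s ⟩
      suc (2 * a + s)                      ∎)
    removed : isRemoved a (suc m) u (s , k) ≡ true
    removed = isRemoved-true a (suc m) u {s} {k} (fromℕ m) (trans s≡ (trans (+-identityʳ N) (sym u-last))) k≡2a+s
  aboveRemoved (suc j) {s} {k} s≡ k≡ j<b _ out = true≢false (trans (sym out) (outside-false (ℓs (suc j)) (here refl) coveredByℓj))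
    where
    open ≡-Reasoning
    narrower : w j ≡ suc (w (suc j))
    narrower with m≤n⇒∃[o]m+o≡n j<b
    ... | r , e = trans (w-def {j} {suc r} (trans (+-suc (suc j) r) e)) (trans (+-suc (2 * a + 2 * m) r) (cong suc (sym (w-def e))))
    coveredByℓj : covers (s , k) (ℓ j) ≡ true
    coveredByℓj = subst (λ y → covers y (ℓ j) ≡ true)
      (cong₂ _,_ (suc-injective (trans (sym (+-suc N j)) (sym s≡))) (trans (cong suc narrower) (sym k≡)))
      (covers-proj₁ (ℓ j))

  step : ∀ j → j < b → Forced (removeLozenges (ℓs j) Vₒ) (ℓ j)
  step j j<b with m≤n⇒∃[o]m+o≡n j<b
  ... | r , e = forcedBy (Unique-removeLozenges (ℓs j) (Unique-V a b (suc m) u))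
                         (kept (t j) t∈V earlierRows) t-down (kept (x j) x∈V earlierRows) adjacent neighbours
    where
    row<T : N + j < 2 * b + 2 * suc m
    row<T = subst (N + j <_) (sym rows≡) (+-monoʳ-< N j<b)
    earlierRows : ∀ {k} → outside (ℓs j) (N + j , k) ≡ true
    earlierRows {k} = outside-ℓs j (λ i i<j → covers-otherRow (N + j , k) (ℓ i) (different i<j) (different i<j))
      where different : ∀ {i} → i < j → N + j ≢ N + i
            different i<j e = <⇒≢ i<j (sym (+-cancelˡ-≡ N j _ e))
    kept : ∀ y → y ∈ Vₒ → outside (ℓs j) y ≡ true → y ∈ removeLozenges (ℓs j) Vₒ
    kept y y∈V out = ∈-filter⁺ (T? ∘ outside (ℓs j)) y∈V (≡true⇒T out)
    t∈V : t j ∈ Vₒ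
    t∈V = ∈-V⁺ a b (suc m) u row<T (subst (suc (w j) <_) (sym (width-old e)) ≤-refl) (unlisted {N + j} {suc (suc (w j))} (m≤m+n N j))
    x∈V : x j ∈ Vₒ
    x∈V = ∈-V⁺ a b (suc m) u row<T (subst (w j <_) (sym (width-old e)) (m<n⇒m<1+n ≤-refl)) (unlisted {N + j} {suc (w j)} (m≤m+n N j))
    t-down : isUp (t j) ≡ false
    t-down = isUp-odd {N + j} {suc (suc (w j))} (suc (j + r + 2 * m + a + 1)) (parity {j} {r} e 2)
    adjacent : upDownAdj (x j) (t j) ≡ true
    adjacent = upDownAdj-east {N + j} {suc (w j)} (isUp-even {N + j} {suc (w j)} (suc (j + r + 2 * m + a + 1)) (parity {j} {r} e 1))
    onlyEast : ∀ {y s k} → UpNeighbour y (s , k) → s ≡ N + j → k ≡ suc (suc (w j)) →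
      y ∈ Vₒ → outside (ℓs j) y ≡ true → y ≡ x j
    onlyEast east  refl refl _ _ = refl
    onlyEast west  refl refl y∈V _ with ∈-V⁻ a b (suc m) u y∈V
    ... | _ , (_ , refl , beyond) , _ = ⊥-elim (<-irrefl (sym (width-old e)) beyond)
    onlyEast above s≡ k≡ y∈V out = ⊥-elim (aboveRemoved j s≡ k≡ j<b y∈V out)
    neighbours : ∀ y → y ∈ removeLozenges (ℓs j) Vₒ → upDownAdj y (t j) ≡ true → y ≡ x j
    neighbours y y∈R adj with ∈-filter⁻ _ {xs = Vₒ} y∈R
    ... | y∈V , out = onlyEast (upNeighbour y (t j) adj) refl refl y∈V (T⇒≡true out)

  p q : Tri → Bool
  p y = not (isRemoved a (suc m) u y) ∧ outside (ℓs b) y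
  q y = not (isRemoved a m u′ y)

  outside-above : ∀ {s k} → s < N → outside (ℓs b) (s , k) ≡ true
  outside-above {s} {k} s<N = outside-ℓs b (λ i _ → covers-otherRow (s , k) (ℓ i) (different i) (different i))
    where different : ∀ i → s ≢ N + i
          different i = <⇒≢ (<-≤-trans s<N (m≤m+n N i))

  N≡ : N ≡ suc (suc b + 2 * m)
  N≡ = regroup b m
    where regroup : ∀ b m → b + 2 * suc m ≡ suc (suc b + 2 * m)
          regroup = solve-∀

  rowAbove : ∀ s → suc s < N → filterᵇ p (row (hexBound a b (suc m)) s) ≡ filterᵇ q (row (hexBound a (suc b) m) s)
  rowAbove s 1+s<N = filterᵇ-row p q s (≤-reflexive widths) agree
    (λ k h≤k k<h → ⊥-elim (<⇒≱ k<h (subst (_≤ k) widths h≤k)))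
    where
    widths : hexBound a (suc b) m s ≡ hexBound a b (suc m) s
    widths = trans (hexBound-upper a (suc b) m s (≤-pred (subst (suc s <_) N≡ 1+s<N)))
                   (sym (hexBound-upper a b (suc m) s (<⇒≤ 1+s<N)))
    agree : ∀ k → k < hexBound a (suc b) m s → p (s , suc k) ≡ q (s , suc k)
    agree k _ = trans (cong₂ _∧_ (cong not (isRemoved-init a m u {s} {suc k} (λ e → <⇒≢ 1+s<N (trans e u-last))))
                                 (outside-above {s} {suc k} (<⇒≤ 1+s<N)))
                      (∧-identityʳ _)

  rowLast : ∀ s → suc s ≡ N → filterᵇ p (row (hexBound a b (suc m)) s) ≡ filterᵇ q (row (hexBound a (suc b) m) s)
  rowLast s 1+s≡N = filterᵇ-row p q s (subst₂ _≤_ (sym new≡) (sym old≡) (n≤1+n h′)) agree surplus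
    where
    h′ = 2 * a + 2 * m + b
    s≡ : s ≡ suc b + 2 * m + 0
    s≡ = trans (suc-injective (trans 1+s≡N N≡)) (sym (+-identityʳ _))
    2a+s≡ : 2 * a + s ≡ suc h′
    2a+s≡ = trans (cong (2 * a +_) s≡) (regroup a b m)
      where regroup : ∀ a b m → 2 * a + (suc b + 2 * m + 0) ≡ suc (2 * a + 2 * m + b)
            regroup = solve-∀
    old≡ : hexBound a b (suc m) s ≡ suc h′
    old≡ = trans (hexBound-upper a b (suc m) s (≤-reflexive 1+s≡N)) 2a+s≡
    new≡ : hexBound a (suc b) m s ≡ h′
    new≡ = trans (cong (hexBound a (suc b) m) s≡) (hexBound-lower a (suc b) m 0 b refl)
    border : ∀ {k} → suc k ≡ suc h′ → suc k ≡ 2 * a + s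
    border e = trans e (sym 2a+s≡)
    agree : ∀ k → k < hexBound a (suc b) m s → p (s , suc k) ≡ q (s , suc k)
    agree k k<h′ = trans (cong₂ _∧_ (cong not (trans (isRemoved-inner a (suc m) u {s} {suc k} inner)
                                                     (sym (isRemoved-inner a m u′ {s} {suc k} inner))))
                                    (outside-above {s} {suc k} (subst (s <_) 1+s≡N ≤-refl)))
                         (∧-identityʳ _)
      where inner : suc k ≢ 2 * a + s
            inner e = <-irrefl (suc-injective (trans e 2a+s≡)) (subst (k <_) new≡ k<h′)
    surplus : ∀ k → hexBound a (suc b) m s ≤ k → k < hexBound a b (suc m) s → p (s , suc k) ≡ false
    surplus k h≤k k<h
      rewrite isRemoved-true a (suc m) u {s} {suc k} (fromℕ m) (trans 1+s≡N (sym u-last))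
                (border (cong suc (≤-antisym (≤-pred (subst (k <_) old≡ k<h)) (subst (_≤ k) new≡ h≤k))))
      = refl

  rowBelow : ∀ j → j < b → filterᵇ p (row (hexBound a b (suc m)) (N + j)) ≡ filterᵇ q (row (hexBound a (suc b) m) (N + j))
  rowBelow j j<b with m≤n⇒∃[o]m+o≡n j<b
  ... | r , e = filterᵇ-row p q (N + j) (subst₂ _≤_ (sym (width-new e)) (sym (width-old e)) (m≤n+m (w j) 2)) agree surplus
    where
    agree : ∀ k → k < hexBound a (suc b) m (N + j) → p (N + j , suc k) ≡ q (N + j , suc k)
    agree k k<h = begin
      not (isRemoved a (suc m) u (N + j , suc k)) ∧ outside (ℓs b) (N + j , suc k)
        ≡⟨ cong₂ (λ r o → not r ∧ o) (unlisted {N + j} {suc k} (m≤m+n N j)) (outside-ℓs b avoid) ⟩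
      true
        ≡⟨ cong not (unlisted′ {N + j} {suc k} (m≤m+n N j)) ⟨
      q (N + j , suc k) ∎
      where
      open ≡-Reasoning
      k<w : k < w j
      k<w = subst (k <_) (width-new e) k<h
      avoid : ∀ i → i < b → covers (N + j , suc k) (ℓ i) ≡ false
      avoid i _ with i ℕ.≟ j
      ... | yes refl = covers-nearer (N + j , suc k) (ℓ j) (s≤s k<w) (s≤s (m<n⇒m<1+n k<w))
      ... | no i≢j = covers-otherRow (N + j , suc k) (ℓ i) different different
        where different = λ e′ → i≢j (sym (+-cancelˡ-≡ N j i e′))
    surplus : ∀ k → hexBound a (suc b) m (N + j) ≤ k → k < hexBound a b (suc m) (N + j) → p (N + j , suc k) ≡ false
    surplus k h≤k k<h = trans (cong (not (isRemoved a (suc m) u (N + j , suc k)) ∧_) (outside-false (ℓs b) (∈-ℓs j<b) covered))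
                              (∧-zeroʳ _)
      where
      covered : covers (N + j , suc k) (ℓ j) ≡ true
      covered with m≤n⇒m<n∨m≡n (≤-pred (subst (k <_) (width-old e) k<h))
      ... | inj₂ refl = covers-proj₂ (ℓ j)
      ... | inj₁ k<1+w with ≤-antisym (≤-pred k<1+w) (subst (_≤ k) (width-new e) h≤k)
      ...   | refl = covers-proj₁ (ℓ j)

  rowwise : ∀ s → s < 2 * b + 2 * suc m →
    filterᵇ p (row (hexBound a b (suc m)) s) ≡ filterᵇ q (row (hexBound a (suc b) m) s)
  rowwise s s<T with <-cmp (suc s) N
  ... | tri< 1+s<N _ _ = rowAbove s 1+s<N
  ... | tri≈ _ 1+s≡N _ = rowLast s 1+s≡N
  ... | tri> _ _ N<1+s with m≤n⇒∃[o]m+o≡n (≤-pred N<1+s)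
  ...   | j , refl = rowBelow j (+-cancelˡ-< N j b (subst (N + j <_) rows≡ s<T))

  removeAll : removeLozenges (ℓs b) Vₒ ≡ V a (suc b) m u′
  removeAll = begin
    removeLozenges (ℓs b) Vₒ
      ≡⟨ filterᵇ-filterᵇ (outside (ℓs b)) (not ∘ isRemoved a (suc m) u) (rows (2 * b + 2 * suc m) (hexBound a b (suc m))) ⟩
    filterᵇ p (rows (2 * b + 2 * suc m) (hexBound a b (suc m)))
      ≡⟨ filterᵇ-rows p q _ _ _ rowwise ⟩
    filterᵇ q (rows (2 * b + 2 * suc m) (hexBound a (suc b) m))
      ≡⟨ cong (λ T → filterᵇ q (rows T (hexBound a (suc b) m))) (regroup b m) ⟩
    V a (suc b) m u′ ∎
    where
    open ≡-Reasoning
    regroup : ∀ b m → 2 * b + 2 * suc m ≡ 2 * suc b + 2 * m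
    regroup = solve-∀

  forcedSequence : ∀ J → J ≤ b → ForcedSequence Vₒ (ℓs J)
  forcedSequence zero    _     = tt
  forcedSequence (suc J) J<b = forcedSequence J (<⇒≤ J<b) , step J J<b

  M-lastEntryMax : M Vₒ ≡ M (V a (suc b) m u′)
  M-lastEntryMax = trans (M-removeForcedSequence Vₒ (ℓs b) (forcedSequence b ≤-refl)) (cong M removeAll)

-- First entry 2: the top two rows are forced

module FirstEntryTwo (a b m : ℕ) (u : Fin (suc m) → ℕ)
  (u₀≡2 : u Fin.zero ≡ 2) (u>2 : ∀ i → 3 ≤ u (Fin.suc i)) where

  Vₒ : Region
  Vₒ = V a b (suc m) u

  u″ : Fin m → ℕ
  u″ i = u (Fin.suc i) ∸ 2

  -- Row 0 is tiled from east to west by ℓ₀ 0, …, ℓ₀ (a - 1), then row 1 from west to east by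
  -- ℓ₁ (a - 1), …, ℓ₁ 0; the triangle (1 , 2a + 1) is removed because u zero ≡ 2.
  ℓ₀ ℓ₁ : ℕ → Tri × Tri
  ℓ₀ j = ((0 , suc (suc (2 * j))) , (0 , suc (2 * j)))
  ℓ₁ r = ((1 , suc (2 * r)) , (1 , suc (suc (2 * r))))

  ℓ₀s : ℕ → List (Tri × Tri)
  ℓ₀s zero    = []
  ℓ₀s (suc j) = ℓ₀ j ∷ ℓ₀s j

  ℓ₁s : ℕ → ℕ → List (Tri × Tri)
  ℓ₁s zero    r = []
  ℓ₁s (suc k) r = ℓ₁ r ∷ ℓ₁s k (suc r)

  ∈-ℓ₀s : ∀ {i J} → i < J → ℓ₀ i ∈ ℓ₀s J
  ∈-ℓ₀s {i} {suc J} i<1+J with m≤n⇒m<n∨m≡n (≤-pred i<1+J)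
  ... | inj₁ i<J  = there (∈-ℓ₀s i<J)
  ... | inj₂ refl = here refl

  ∈-ℓ₁s : ∀ {k r r′} → r ≤ r′ → r′ < r + k → ℓ₁ r′ ∈ ℓ₁s k r
  ∈-ℓ₁s {zero}  {r} r≤r′ r′<r+0 = ⊥-elim (<⇒≱ r′<r+0 (subst (_≤ _) (sym (+-identityʳ r)) r≤r′))
  ∈-ℓ₁s {suc k} {r} {r′} r≤r′ r′<r+k with m≤n⇒m<n∨m≡n r≤r′
  ... | inj₂ refl = here refl
  ... | inj₁ r<r′ = there (∈-ℓ₁s r<r′ (subst (r′ <_) (+-suc r k) r′<r+k))

  All-ℓ₀s : ∀ {P : Tri × Tri → Set} J → (∀ i → i < J → P (ℓ₀ i)) → All P (ℓ₀s J)
  All-ℓ₀s zero    _  = []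
  All-ℓ₀s (suc J) Pℓ = Pℓ J ≤-refl ∷ All-ℓ₀s J (λ i i<J → Pℓ i (m<n⇒m<1+n i<J))

  All-ℓ₁s : ∀ {P : Tri × Tri → Set} k r → (∀ r′ → r ≤ r′ → P (ℓ₁ r′)) → All P (ℓ₁s k r)
  All-ℓ₁s zero    r _  = []
  All-ℓ₁s (suc k) r Pℓ = Pℓ r ≤-refl ∷ All-ℓ₁s k (suc r) (λ r′ r<r′ → Pℓ r′ (<⇒≤ r<r′))

  rows≡ : 2 * b + 2 * suc m ≡ suc (suc (2 * b + 2 * m))
  rows≡ = regroup b m
    where regroup : ∀ b m → 2 * b + 2 * suc m ≡ suc (suc (2 * b + 2 * m))
          regroup = solve-∀

  N≡ : b + 2 * suc m ≡ suc (suc (b + 2 * m))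
  N≡ = regroup b m
    where regroup : ∀ b m → b + 2 * suc m ≡ suc (suc (b + 2 * m))
          regroup = solve-∀

  width₀ : hexBound a b (suc m) 0 ≡ 2 * a
  width₀ = trans (hexBound-upper a b (suc m) 0 (subst (1 ≤_) (sym N≡) (s≤s z≤n))) (+-identityʳ (2 * a))

  width₁ : hexBound a b (suc m) 1 ≡ suc (2 * a)
  width₁ = trans (hexBound-upper a b (suc m) 1 (subst (2 ≤_) (sym N≡) (s≤s (s≤s z≤n)))) (+-comm (2 * a) 1)

  unlisted₀ : ∀ {k} → isRemoved a (suc m) u (0 , k) ≡ false
  unlisted₀ {k} = isRemoved-unlisted a (suc m) u {0} {k} 1∉u
    where
    1∉u : ∀ i → 1 ≢ u i
    1∉u Fin.zero    1≡u₀ = case trans 1≡u₀ u₀≡2 of λ ()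
    1∉u (Fin.suc i) 1≡uᵢ = <⇒≢ (≤-trans (s≤s (s≤s z≤n)) (u>2 i)) 1≡uᵢ

  double-suc : ∀ j → 2 * suc j ≡ suc (suc (2 * j))
  double-suc = solve-∀

  2+2j≤2a : ∀ {j} → j < a → suc (suc (2 * j)) ≤ 2 * a
  2+2j≤2a {j} j<a = subst (_≤ 2 * a) (double-suc j) (*-monoʳ-≤ 2 j<a)

  kept : ∀ ℓs {y} → y ∈ Vₒ → outside ℓs y ≡ true → y ∈ removeLozenges ℓs Vₒ
  kept ℓs y∈V out = ∈-filter⁺ (T? ∘ outside ℓs) y∈V (≡true⇒T out)

  eastOfRow₀ : ∀ j {k} → k ≡ 2 * j → (0 , k) ∈ Vₒ → outside (ℓ₀s j) (0 , k) ≡ true → ⊥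
  eastOfRow₀ zero    refl y∈V _ with ∈-V⁻ a b (suc m) u y∈V
  ... | _ , (_ , () , _) , _
  eastOfRow₀ (suc j) k≡ _ out = true≢false (trans (sym out) (outside-false (ℓ₀s (suc j)) (here refl)
    (subst (λ k → covers (0 , k) (ℓ₀ j) ≡ true) (sym (trans k≡ (double-suc j))) (covers-proj₁ (ℓ₀ j)))))

  step₀ : ∀ j → j < a → Forced (removeLozenges (ℓ₀s j) Vₒ) (ℓ₀ j)
  step₀ j j<a = forcedBy (Unique-removeLozenges (ℓ₀s j) (Unique-V a b (suc m) u))
                         (kept (ℓ₀s j) t∈V (earlier ≤-refl)) t-down (kept (ℓ₀s j) x∈V (earlier (m<n⇒m<1+n ≤-refl))) adjacent neighbours
    where
    t x : Tri
    t = (0 , suc (2 * j))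
    x = (0 , suc (suc (2 * j)))
    0<T : 0 < 2 * b + 2 * suc m
    0<T = subst (0 <_) (sym rows≡) (s≤s z≤n)
    t∈V : t ∈ Vₒ
    t∈V = ∈-V⁺ a b (suc m) u 0<T (subst (2 * j <_) (sym width₀) (≤-trans (n≤1+n _) (2+2j≤2a j<a))) (unlisted₀ {suc (2 * j)})
    x∈V : x ∈ Vₒ
    x∈V = ∈-V⁺ a b (suc m) u 0<T (subst (suc (2 * j) <_) (sym width₀) (2+2j≤2a j<a)) (unlisted₀ {suc (suc (2 * j))})
    earlier : ∀ {k} → 2 * j < k → outside (ℓ₀s j) (0 , k) ≡ true
    earlier {k} 2j<k = outside-true (ℓ₀s j) (All-ℓ₀s j (λ i i<j →
      let 2+2i<k = ≤-<-trans (subst (_≤ 2 * j) (double-suc i) (*-monoʳ-≤ 2 i<j)) 2j<k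
      in covers-farther (0 , k) (ℓ₀ i) 2+2i<k (<-trans (n<1+n _) 2+2i<k)))
    t-down : isUp t ≡ false
    t-down = isUp-odd {0} {suc (2 * j)} j (regroup j)
      where regroup : ∀ j → suc (2 * j) ≡ 1 + j * 2
            regroup = solve-∀
    adjacent : upDownAdj x t ≡ true
    adjacent = upDownAdj-west {0} {suc (2 * j)} (isUp-even {0} {suc (suc (2 * j))} (suc j) (regroup j))
      where regroup : ∀ j → suc (suc (2 * j)) ≡ suc j * 2
            regroup = solve-∀
    onlyWest : ∀ {y s k} → UpNeighbour y (s , k) → s ≡ 0 → k ≡ suc (2 * j) →
      y ∈ Vₒ → outside (ℓ₀s j) y ≡ true → y ≡ x
    onlyWest east  refl k≡   y∈V out = ⊥-elim (eastOfRow₀ j (suc-injective k≡) y∈V out)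
    onlyWest west  refl refl _   _   = refl
    onlyWest above ()   _    _   _
    neighbours : ∀ y → y ∈ removeLozenges (ℓ₀s j) Vₒ → upDownAdj y t ≡ true → y ≡ x
    neighbours y y∈R adj with ∈-filter⁻ (T? ∘ outside (ℓ₀s j)) {xs = Vₒ} y∈R
    ... | y∈V , out = onlyWest (upNeighbour y t adj) refl refl y∈V (T⇒≡true out)

  removed₁ : ∀ {k} → k ≡ suc (2 * a) → isRemoved a (suc m) u (1 , k) ≡ true
  removed₁ {k} k≡ = isRemoved-true a (suc m) u {1} {k} Fin.zero (sym u₀≡2) (trans k≡ (+-comm 1 (2 * a)))

  westOfRow₁ : ∀ k r {k₀} → r + suc k ≡ a → k₀ ≡ suc (suc (2 * r)) → (1 , suc k₀) ∈ Vₒ →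
    outside (ℓ₁s k (suc r) ++ ℓ₀s a) (1 , suc k₀) ≡ true → ⊥
  westOfRow₁ zero r {k₀} r+1≡a k₀≡ y∈V _ =
    true≢false (trans (sym (removed₁ (cong suc (trans k₀≡ (trans (sym (double-suc r)) (sym edge))))))
                      (proj₂ (proj₂ (∈-V⁻ a b (suc m) u y∈V))))
    where
    edge : 2 * a ≡ 2 * suc r
    edge = cong (2 *_) (trans (sym r+1≡a) (+-comm r 1))
  westOfRow₁ (suc k) r {k₀} _ k₀≡ _ out =
    true≢false (trans (sym out) (outside-false (ℓ₁s (suc k) (suc r) ++ ℓ₀s a) (here refl)
      (subst (λ k′ → covers (1 , k′) (ℓ₁ (suc r)) ≡ true) (cong suc (sym (trans k₀≡ (sym (double-suc r))))) (covers-proj₁ (ℓ₁ (suc r))))))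

  step₁ : ∀ k r → r + suc k ≡ a → Forced (removeLozenges (ℓ₁s k (suc r) ++ ℓ₀s a) Vₒ) (ℓ₁ r)
  step₁ k r r+1+k≡a = forcedBy (Unique-removeLozenges ℓs (Unique-V a b (suc m) u))
                               (kept ℓs t∈V (later ≤-refl)) t-down (kept ℓs x∈V (later (n≤1+n _))) adjacent neighbours
    where
    ℓs = ℓ₁s k (suc r) ++ ℓ₀s a
    t x : Tri
    t = (1 , suc (suc (2 * r)))
    x = (1 , suc (2 * r))
    r<a : r < a
    r<a = subst (r <_) r+1+k≡a (m<m+n r z<s)
    1<T : 1 < 2 * b + 2 * suc m
    1<T = subst (1 <_) (sym rows≡) (s≤s (s≤s z≤n))
    inner : ∀ {k′} → k′ ≤ 2 * a → isRemoved a (suc m) u (1 , k′) ≡ false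
    inner {k′} k′≤2a = isRemoved-inner a (suc m) u {1} {k′} (λ e → <⇒≢ (s≤s k′≤2a) (trans e (+-comm (2 * a) 1)))
    t∈V : t ∈ Vₒ
    t∈V = ∈-V⁺ a b (suc m) u 1<T (subst (suc (2 * r) <_) (sym width₁) (s≤s (≤-trans (n≤1+n _) (2+2j≤2a r<a)))) (inner (2+2j≤2a r<a))
    x∈V : x ∈ Vₒ
    x∈V = ∈-V⁺ a b (suc m) u 1<T (subst (2 * r <_) (sym width₁) (s≤s (≤-trans (n≤1+n _) (≤-trans (n≤1+n _) (2+2j≤2a r<a)))))
                (inner (≤-trans (n≤1+n _) (2+2j≤2a r<a)))
    later : ∀ {k′} → k′ ≤ suc (suc (2 * r)) → outside ℓs (1 , k′) ≡ true
    later {k′} k′≤ = outside-true {1 , k′} ℓs (Allₚ.++⁺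
      (All-ℓ₁s k (suc r) (λ r′ r<r′ → let k′≤2r′ = ≤-trans k′≤ (subst (_≤ 2 * r′) (double-suc r) (*-monoʳ-≤ 2 r<r′))
                                      in covers-nearer (1 , k′) (ℓ₁ r′) (s≤s k′≤2r′) (s≤s (≤-trans k′≤2r′ (n≤1+n _)))))
      (All-ℓ₀s a (λ i _ → covers-otherRow (1 , k′) (ℓ₀ i) (λ ()) (λ ()))))
    t-down : isUp t ≡ false
    t-down = isUp-odd {1} {suc (suc (2 * r))} (suc r) (regroup r)
      where regroup : ∀ r → 1 + suc (suc (2 * r)) ≡ 1 + suc r * 2
            regroup = solve-∀
    adjacent : upDownAdj x t ≡ true
    adjacent = upDownAdj-east {1} {suc (2 * r)} (isUp-even {1} {suc (2 * r)} (suc r) (regroup r))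
      where regroup : ∀ r → 1 + suc (2 * r) ≡ suc r * 2
            regroup = solve-∀
    onlyEast : ∀ {y s k′} → UpNeighbour y (s , k′) → s ≡ 1 → k′ ≡ suc (suc (2 * r)) →
      y ∈ Vₒ → outside ℓs y ≡ true → y ≡ x
    onlyEast east  refl refl _   _   = refl
    onlyEast west  refl k′≡  y∈V out = ⊥-elim (westOfRow₁ k r r+1+k≡a k′≡ y∈V out)
    onlyEast above refl refl _   out = ⊥-elim (true≢false (trans (sym out)
      (outside-false ℓs (∈-++⁺ʳ (ℓ₁s k (suc r)) (∈-ℓ₀s r<a)) (covers-proj₁ (ℓ₀ r)))))
    neighbours : ∀ y → y ∈ removeLozenges ℓs Vₒ → upDownAdj y t ≡ true → y ≡ x
    neighbours y y∈R adj with ∈-filter⁻ (T? ∘ outside ℓs) {xs = Vₒ} y∈R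
    ... | y∈V , out = onlyEast (upNeighbour y t adj) refl refl y∈V (T⇒≡true out)

  forcedSequence₀ : ∀ J → J ≤ a → ForcedSequence Vₒ (ℓ₀s J)
  forcedSequence₀ zero    _   = tt
  forcedSequence₀ (suc J) J<a = forcedSequence₀ J (<⇒≤ J<a) , step₀ J J<a

  forcedSequence₁ : ∀ k r → r + k ≡ a → ForcedSequence Vₒ (ℓ₁s k r ++ ℓ₀s a)
  forcedSequence₁ zero    r _     = forcedSequence₀ a ≤-refl
  forcedSequence₁ (suc k) r r+k≡a = forcedSequence₁ k (suc r) (trans (sym (+-suc r k)) r+k≡a) , step₁ k r r+k≡a

  ℓs : List (Tri × Tri)
  ℓs = ℓ₁s a 0 ++ ℓ₀s a

  p q : Tri → Bool
  p y = not (isRemoved a (suc m) u y) ∧ outside ℓs y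
  q y = not (isRemoved (suc a) m u″ y)

  covered : ∀ {y ℓ} → ℓ ∈ ℓs → covers y ℓ ≡ true → p y ≡ false
  covered {y} ℓ∈ℓs yℓ = trans (cong (not (isRemoved a (suc m) u y) ∧_) (outside-false ℓs ℓ∈ℓs yℓ)) (∧-zeroʳ _)

  row₀ : filterᵇ p (row (hexBound a b (suc m)) 0) ≡ []
  row₀ = filterᵇ-row p p 0 z≤n (λ _ ()) surplus
    where
    surplus : ∀ k → 0 ≤ k → k < hexBound a b (suc m) 0 → p (0 , suc k) ≡ false
    surplus k _ k<h with half k | subst (k <_) width₀ k<h
    ... | j , inj₁ refl | 2j<2a  = covered (∈-++⁺ʳ (ℓ₁s a 0) (∈-ℓ₀s (*-cancelˡ-< 2 j a 2j<2a))) (covers-proj₂ (ℓ₀ j))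
    ... | j , inj₂ refl | 1+2j<2a = covered (∈-++⁺ʳ (ℓ₁s a 0) (∈-ℓ₀s (*-cancelˡ-< 2 j a (<-trans (n<1+n _) 1+2j<2a))))
                                            (covers-proj₁ (ℓ₀ j))

  row₁ : filterᵇ p (row (hexBound a b (suc m)) 1) ≡ []
  row₁ = filterᵇ-row p p 1 z≤n (λ _ ()) surplus
    where
    surplus : ∀ k → 0 ≤ k → k < hexBound a b (suc m) 1 → p (1 , suc k) ≡ false
    surplus k _ k<h with half k | subst (k <_) width₁ k<h
    ... | j , inj₂ refl | 1+2j<1+2a = covered (∈-++⁺ˡ (∈-ℓ₁s z≤n (*-cancelˡ-< 2 j a (≤-pred 1+2j<1+2a)))) (covers-proj₂ (ℓ₁ j))
    ... | j , inj₁ refl | 2j<1+2a with m≤n⇒m<n∨m≡n (*-cancelˡ-≤ {j} {a} 2 (≤-pred 2j<1+2a))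
    ...   | inj₁ j<a  = covered (∈-++⁺ˡ (∈-ℓ₁s z≤n j<a)) (covers-proj₁ (ℓ₁ j))
    ...   | inj₂ refl rewrite removed₁ {suc (2 * j)} refl = refl

  isRemoved-down₂ : ∀ s k → isRemoved a (suc m) u (down₂ (s , k)) ≡ isRemoved (suc a) m u″ (s , k)
  isRemoved-down₂ s k = Bool-ext forward backward
    where
    shift : 2 * a + suc (suc s) ≡ 2 * suc a + s
    shift = regroup a s
      where regroup : ∀ a s → 2 * a + suc (suc s) ≡ 2 * suc a + s
            regroup = solve-∀
    forward : isRemoved a (suc m) u (down₂ (s , k)) ≡ true → isRemoved (suc a) m u″ (s , k) ≡ true
    forward e with isRemoved⇒ a (suc m) u {suc (suc s)} {k} e
    ... | (Fin.zero , 3+s≡u₀) , _ = case trans 3+s≡u₀ u₀≡2 of λ ()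
    ... | (Fin.suc i , 3+s≡uᵢ) , border = isRemoved-true (suc a) m u″ {s} {k} i (cong (_∸ 2) 3+s≡uᵢ) (trans border shift)
    backward : isRemoved (suc a) m u″ (s , k) ≡ true → isRemoved a (suc m) u (down₂ (s , k)) ≡ true
    backward e with isRemoved⇒ (suc a) m u″ {s} {k} e
    ... | (i , 1+s≡u″ᵢ) , border =
      isRemoved-true a (suc m) u {suc (suc s)} {k} (Fin.suc i)
        (trans (cong (ℕ.suc ∘ ℕ.suc) 1+s≡u″ᵢ) (m+[n∸m]≡n (≤-trans (n≤1+n 2) (u>2 i)))) (trans border (sym shift))

  rowShifted : ∀ s → s < 2 * b + 2 * m →
    filterᵇ p (row (hexBound a b (suc m)) (suc (suc s))) ≡ map down₂ (filterᵇ q (row (hexBound (suc a) b m) s))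
  rowShifted s _ = filterᵇ-row-down₂ p q s (hexBound-suc-suc a b m s) agree
    where
    below₁ : ∀ {k} → outside ℓs (suc (suc s) , k) ≡ true
    below₁ {k} = outside-true ℓs (Allₚ.++⁺ (All-ℓ₁s a 0 (λ r′ _ → covers-otherRow (suc (suc s) , k) (ℓ₁ r′) (λ ()) (λ ())))
                                         (All-ℓ₀s a (λ i _ → covers-otherRow (suc (suc s) , k) (ℓ₀ i) (λ ()) (λ ()))))
    agree : ∀ k → k < hexBound (suc a) b m s → p (down₂ (s , suc k)) ≡ q (s , suc k)
    agree k _ = trans (cong₂ (λ r o → not r ∧ o) (isRemoved-down₂ s (suc k)) below₁) (∧-identityʳ _)

  removeAll : removeLozenges ℓs Vₒ ≡ map down₂ (V (suc a) b m u″)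
  removeAll = begin
    removeLozenges ℓs Vₒ
      ≡⟨ filterᵇ-filterᵇ (outside ℓs) (not ∘ isRemoved a (suc m) u) (rows (2 * b + 2 * suc m) (hexBound a b (suc m))) ⟩
    filterᵇ p (rows (2 * b + 2 * suc m) (hexBound a b (suc m)))
      ≡⟨ cong (λ T → filterᵇ p (rows T (hexBound a b (suc m)))) rows≡ ⟩
    filterᵇ p (rows (suc (suc (2 * b + 2 * m))) (hexBound a b (suc m)))
      ≡⟨ filterᵇ-rows-down₂ p q (2 * b + 2 * m) (hexBound a b (suc m)) (hexBound (suc a) b m) row₀ row₁ rowShifted ⟩
    map down₂ (V (suc a) b m u″) ∎
    where open ≡-Reasoning

  M-firstEntryTwo : M Vₒ ≡ M (V (suc a) b m u″)
  M-firstEntryTwo = begin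
    M Vₒ                             ≡⟨ M-removeForcedSequence Vₒ ℓs (forcedSequence₁ a 0 refl) ⟩
    M (removeLozenges ℓs Vₒ)         ≡⟨ cong M removeAll ⟩
    M (map down₂ (V (suc a) b m u″)) ≡⟨ M-down₂ (V (suc a) b m u″) ⟩
    M (V (suc a) b m u″)             ∎
    where open ≡-Reasoning

-- The rational function F

ratio-pos : ∀ {n d} → 0 < n → 0 < d → Positive (ratio n d)
ratio-pos {suc n} {suc d} _ _ = ℚₚ.normalize-pos (suc n) (suc d)

ratio-nonzero : ∀ {n d} → 0 < n → 0 < d → ratio n d ≢ 0ℚ
ratio-nonzero 0<n 0<d r≡0 = ℚₚ.<-irrefl (sym r≡0) (ℚₚ.positive⁻¹ _ {{ratio-pos 0<n 0<d}})

ratio-cross : ∀ {n₁ d₁ c e n₂ d₂} → 0 < d₁ → 0 < e → 0 < d₂ →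
  n₁ * (e * d₂) ≡ c * n₂ * d₁ → ratio n₁ d₁ ≡ ratio c e ℚ.* ratio n₂ d₂
ratio-cross {n₁} {suc d₁} {c} {suc e} {n₂} {suc d₂} _ _ _ cross =
  ℚₚ.toℚᵘ-injective (ℚᵘ.≃-trans (ℚₚ.toℚᵘ-fromℚᵘ (mkℚᵘ (ℤ.+ n₁) d₁))
    (ℚᵘ.≃-trans (*≡* integral)
      (ℚᵘ.≃-sym (ℚᵘ.≃-trans (ℚₚ.toℚᵘ-homo-* (ratio c (suc e)) (ratio n₂ (suc d₂)))
        (ℚᵘ.*-cong (ℚₚ.toℚᵘ-fromℚᵘ (mkℚᵘ (ℤ.+ c) e)) (ℚₚ.toℚᵘ-fromℚᵘ (mkℚᵘ (ℤ.+ n₂) d₂)))))))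
  where
  integral : ℤ.+ n₁ ℤ.* ℤ.+ (suc e * suc d₂) ≡ ℤ.+ c ℤ.* ℤ.+ n₂ ℤ.* ℤ.+ suc d₁
  integral = begin
    ℤ.+ n₁ ℤ.* ℤ.+ (suc e * suc d₂)      ≡⟨ ℤₚ.pos-* n₁ _ ⟨
    ℤ.+ (n₁ * (suc e * suc d₂))          ≡⟨ cong ℤ.+_ cross ⟩
    ℤ.+ (c * n₂ * suc d₁)                ≡⟨ ℤₚ.pos-* (c * n₂) _ ⟩
    ℤ.+ (c * n₂) ℤ.* ℤ.+ suc d₁          ≡⟨ cong (ℤ._* ℤ.+ suc d₁) (ℤₚ.pos-* c n₂) ⟩
    ℤ.+ c ℤ.* ℤ.+ n₂ ℤ.* ℤ.+ suc d₁      ∎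
    where open ≡-Reasoning

prod-cong : ∀ k {g h : ℕ → ℕ} → (∀ i → g i ≡ h i) → prod k g ≡ prod k h
prod-cong zero    g≗h = refl
prod-cong (suc k) g≗h = cong₂ _*_ (prod-cong k g≗h) (g≗h k)

prod-suc : ∀ k (g : ℕ → ℕ) → prod (suc k) g ≡ g 0 * prod k (λ i → g (suc i))
prod-suc zero    g = *-comm 1 (g 0)
prod-suc (suc k) g = begin
  prod (suc k) g * g (suc k)                     ≡⟨ cong (_* g (suc k)) (prod-suc k g) ⟩
  g 0 * prod k (λ i → g (suc i)) * g (suc k)     ≡⟨ *-assoc (g 0) _ _ ⟩
  g 0 * (prod k (λ i → g (suc i)) * g (suc k))   ∎
  where open ≡-Reasoning

prod-pos : ∀ k {g : ℕ → ℕ} → (∀ i → 0 < g i) → 0 < prod k g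
prod-pos zero    g>0 = z<s
prod-pos (suc k) g>0 = *-mono-< (prod-pos k g>0) (g>0 k)

prodFin-cong : ∀ n {g h : Fin n → ℕ} → (∀ i → g i ≡ h i) → prodFin n g ≡ prodFin n h
prodFin-cong zero    g≗h = refl
prodFin-cong (suc n) g≗h = cong₂ _*_ (g≗h Fin.zero) (prodFin-cong n (λ i → g≗h (Fin.suc i)))

prodFin-pos : ∀ n {g : Fin n → ℕ} → (∀ i → 0 < g i) → 0 < prodFin n g
prodFin-pos zero    g>0 = z<s
prodFin-pos (suc n) g>0 = *-mono-< (g>0 Fin.zero) (prodFin-pos n (λ i → g>0 (Fin.suc i)))

prodFin-last : ∀ n (g : Fin (suc n) → ℕ) → prodFin (suc n) g ≡ prodFin n (λ i → g (inject₁ i)) * g (fromℕ n)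
prodFin-last zero    g = *-comm (g Fin.zero) 1
prodFin-last (suc n) g = begin
  g Fin.zero * prodFin (suc n) (λ i → g (Fin.suc i))
    ≡⟨ cong (g Fin.zero *_) (prodFin-last n (λ i → g (Fin.suc i))) ⟩
  g Fin.zero * (prodFin n (λ i → g (Fin.suc (inject₁ i))) * g (Fin.suc (fromℕ n)))
    ≡⟨ *-assoc (g Fin.zero) _ _ ⟨
  g Fin.zero * prodFin n (λ i → g (Fin.suc (inject₁ i))) * g (Fin.suc (fromℕ n)) ∎
  where open ≡-Reasoning

prodTri-suc : ∀ k (g : ℕ → ℕ → ℕ) →
  prodTri (suc k) g ≡ prod (suc k) (λ j → g 1 (suc j)) * prodTri k (λ i j → g (suc i) (suc j))
prodTri-suc k g = prod-suc k _

prodTri-cong : ∀ k {g h : ℕ → ℕ → ℕ} → (∀ i j → g i j ≡ h i j) → prodTri k g ≡ prodTri k h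
prodTri-cong k g≗h = prod-cong k (λ i → prod-cong (k ∸ i) (λ j → g≗h _ _))

prodTri-pos : ∀ k {g : ℕ → ℕ → ℕ} → (∀ i j → i ≤ j → 0 < g (suc i) (suc j)) → 0 < prodTri k g
prodTri-pos k g>0 = prod-pos k (λ i → prod-pos (k ∸ i) (λ j → g>0 i (i + j) (m≤m+n i j)))

poch-pos : ∀ k {y} → 0 < y → 0 < poch y k
poch-pos zero    y>0 = z<s
poch-pos (suc k) y>0 = *-mono-< y>0 (poch-pos k z<s)

prod-poch : ∀ k y → prod k (λ j → y + j) ≡ poch y k
prod-poch zero    y = refl
prod-poch (suc k) y = begin
  prod (suc k) (λ j → y + j)        ≡⟨ prod-suc k (λ j → y + j) ⟩
  (y + 0) * prod k (λ j → y + suc j) ≡⟨ cong₂ _*_ (+-identityʳ y) (prod-cong k (λ j → +-suc y j)) ⟩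
  y * prod k (λ j → suc y + j)      ≡⟨ cong (y *_) (prod-poch k (suc y)) ⟩
  y * poch (suc y) k                ∎
  where open ≡-Reasoning

denTri : ℕ → ℕ
denTri k = prodTri k (λ i j → i + j ∸ 1)

numTri : ℕ → ℕ → ℕ
numTri x k = prodTri k (λ i j → 2 * x + i + j ∸ 1)

denTri-pos : ∀ k → 0 < denTri k
denTri-pos k = prodTri-pos k {λ i j → i + j ∸ 1} (λ i j _ → subst (0 <_) (sym (+-suc i j)) z<s)

numTri-suc : ∀ x k → numTri x (suc k) ≡ poch (2 * x + 1) (suc k) * numTri (suc x) k
numTri-suc x k = begin
  numTri x (suc k)
    ≡⟨ prodTri-suc k (λ i j → 2 * x + i + j ∸ 1) ⟩
  prod (suc k) (λ j → 2 * x + 1 + suc j ∸ 1) * prodTri k (λ i j → 2 * x + suc i + suc j ∸ 1)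
    ≡⟨ cong₂ _*_ (prod-cong (suc k) (λ j → cong (_∸ 1) (+-suc (2 * x + 1) j)))
                 (prodTri-cong k (λ i j → cong (_∸ 1) (shift x i j))) ⟩
  prod (suc k) (λ j → 2 * x + 1 + j) * numTri (suc x) k
    ≡⟨ cong (_* numTri (suc x) k) (prod-poch (suc k) (2 * x + 1)) ⟩
  poch (2 * x + 1) (suc k) * numTri (suc x) k ∎
  where
  open ≡-Reasoning
  shift : ∀ x i j → 2 * x + suc i + suc j ≡ 2 * suc x + i + j
  shift = solve-∀

-- Cross-multiplied form of  P(x, B + 1) / (2x + 2)_B = (c / e) · P(x + 1, B).
P-shift : ∀ B → ∃₂ λ c e → 0 < c × 0 < e × ∀ x →
  numP x (suc B) * (e * denP (suc x) B) ≡ c * numP (suc x) B * (denP x (suc B) * poch (2 * x + 2) B)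
P-shift zero    = 1 , 1 , z<s , z<s , λ x → refl
P-shift (suc k) = denTri k , 2 * denTri (suc k) , denTri-pos k , *-monoʳ-< 2 (denTri-pos (suc k)) , identity
  where
  rearrange : ∀ x R₁ Θ P R₂ D D′ →
    suc x * R₁ * (P * Θ) * (2 * D′ * (R₂ * D)) ≡ D * (R₁ * Θ) * (P * D′ * ((2 * x + 2) * R₂))
  rearrange = solve-∀
  identity : ∀ x → numP x (suc (suc k)) * (2 * denTri (suc k) * denP (suc x) (suc k))
                 ≡ denTri k * numP (suc x) (suc k) * (denP x (suc (suc k)) * poch (2 * x + 2) (suc k))
  identity x = begin
    suc x * R₁ * numTri x (suc k) * (2 * D′ * (poch (2 * suc x + 1) k * D))
      ≡⟨ cong₂ (λ t y → suc x * R₁ * t * (2 * D′ * (poch y k * D))) (numTri-suc x k) (odd x) ⟩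
    suc x * R₁ * (P * Θ) * (2 * D′ * (R₂ * D))
      ≡⟨ rearrange x R₁ Θ P R₂ D D′ ⟩
    D * (R₁ * Θ) * (P * D′ * ((2 * x + 2) * R₂)) ∎
    where
    open ≡-Reasoning
    R₁ = poch (suc (suc x)) k
    Θ = numTri (suc x) k
    P = poch (2 * x + 1) (suc k)
    R₂ = poch (suc (2 * x + 2)) k
    D = denTri k
    D′ = denTri (suc k)
    odd : ∀ x → 2 * suc x + 1 ≡ suc (2 * x + 2)
    odd = solve-∀

denW-pos : ∀ b n w x → (∀ i → 1 ≤ w i) → 0 < denW b n w x
denW-pos b n w x w≥1 = prodFin-pos n (λ i → poch-pos (b + n + suc (toℕ i) ∸ w i) (≤-trans (w≥1 i) (m≤n+m (w i) (2 * x))))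

denP-pos : ∀ x B → 0 < denP x B
denP-pos x B = *-mono-< (poch-pos (B ∸ 1) (subst (0 <_) (+-comm 1 (2 * x)) z<s)) (denTri-pos (B ∸ 1))

denW-lastEntryMax : ∀ b m (u : Fin (suc m) → ℕ) x → u (fromℕ m) ≡ b + 2 * suc m →
  denW b (suc m) u x ≡ denW (suc b) m (λ i → u (inject₁ i)) x
denW-lastEntryMax b m u x u-last = begin
  denW b (suc m) u x
    ≡⟨ prodFin-last m (λ i → poch (2 * x + u i) (b + suc m + suc (toℕ i) ∸ u i)) ⟩
  prodFin m (λ i → poch (2 * x + u (inject₁ i)) (b + suc m + suc (toℕ (inject₁ i)) ∸ u (inject₁ i)))
    * poch (2 * x + u (fromℕ m)) (b + suc m + suc (toℕ (fromℕ m)) ∸ u (fromℕ m))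
    ≡⟨ cong₂ _*_ (prodFin-cong m (λ i → cong (λ l → poch (2 * x + u (inject₁ i)) (l ∸ u (inject₁ i))) (length≡ i)))
                 (cong (poch (2 * x + u (fromℕ m))) emptyLength) ⟩
  denW (suc b) m (λ i → u (inject₁ i)) x * 1
    ≡⟨ *-identityʳ _ ⟩
  denW (suc b) m (λ i → u (inject₁ i)) x ∎
  where
  open ≡-Reasoning
  length≡ : ∀ i → b + suc m + suc (toℕ (inject₁ i)) ≡ suc b + m + suc (toℕ i)
  length≡ i = cong₂ (λ l t → l + suc t) (+-suc b m) (toℕ-inject₁ i)
  emptyLength : b + suc m + suc (toℕ (fromℕ m)) ∸ u (fromℕ m) ≡ 0
  emptyLength rewrite toℕ-fromℕ m | u-last = m≤n⇒m∸n≡0 (≤-reflexive (twice b m))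
    where twice : ∀ b m → b + suc m + suc m ≡ b + 2 * suc m
          twice = solve-∀

denW-firstEntryTwo : ∀ b m (u : Fin (suc m) → ℕ) x → u Fin.zero ≡ 2 → (∀ i → 2 ≤ u (Fin.suc i)) →
  denW b (suc m) u x ≡ poch (2 * x + 2) (b + m) * denW b m (λ i → u (Fin.suc i) ∸ 2) (suc x)
denW-firstEntryTwo b m u x u₀≡2 u≥2 =
  cong₂ _*_ first (prodFin-cong m (λ i → shifted (toℕ i) (u (Fin.suc i)) (u≥2 i)))
  where
  first : poch (2 * x + u Fin.zero) (b + suc m + 1 ∸ u Fin.zero) ≡ poch (2 * x + 2) (b + m)
  first rewrite u₀≡2 = cong (poch (2 * x + 2)) (cong (_∸ 2) (length≡ b m))
    where length≡ : ∀ b m → b + suc m + 1 ≡ 2 + (b + m)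
          length≡ = solve-∀
  shifted : ∀ t w → 2 ≤ w →
    poch (2 * x + w) (b + suc m + suc (suc t) ∸ w) ≡ poch (2 * suc x + (w ∸ 2)) (b + m + suc t ∸ (w ∸ 2))
  shifted t 1 (s≤s ())
  shifted t (suc (suc v)) _ = cong₂ poch (base x v) (cong (_∸ suc (suc v)) (length≡ b m t))
    where base : ∀ x v → 2 * x + suc (suc v) ≡ 2 * suc x + v
          base = solve-∀
          length≡ : ∀ b m t → b + suc m + suc (suc t) ≡ suc (suc (b + m + suc t))
          length≡ = solve-∀

F-lastEntryMax : ∀ b m (u : Fin (suc m) → ℕ) → u (fromℕ m) ≡ b + 2 * suc m →
  (λ x → F b (suc m) u x) ≡ₐ (λ x → F (suc b) m (λ i → u (inject₁ i)) x)
F-lastEntryMax b m u u-last = 1ℚ , ratio-nonzero {1} {1} z<s z<s , λ x → begin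
  F b (suc m) u x
    ≡⟨ cong₂ (λ B d → ratio (numP x B) (denP x B * d)) (+-suc b m) (denW-lastEntryMax b m u x u-last) ⟩
  F (suc b) m (λ i → u (inject₁ i)) x
    ≡⟨ ℚₚ.*-identityˡ _ ⟨
  1ℚ ℚ.* F (suc b) m (λ i → u (inject₁ i)) x ∎
  where open ≡-Reasoning

F-firstEntryTwo : ∀ b m (u : Fin (suc m) → ℕ) → u Fin.zero ≡ 2 → (∀ i → 3 ≤ u (Fin.suc i)) →
  (λ x → F b (suc m) u x) ≡ₐ (λ x → F b m (λ i → u (Fin.suc i) ∸ 2) (suc x))
F-firstEntryTwo b m u u₀≡2 u>2 with P-shift (b + m)
... | c , e , c>0 , e>0 , shift = ratio c e , ratio-nonzero c>0 e>0 , λ x → begin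
  F b (suc m) u x
    ≡⟨ cong₂ (λ B d → ratio (numP x B) (denP x B * d)) (+-suc b m)
             (denW-firstEntryTwo b m u x u₀≡2 (λ i → ≤-trans (n≤1+n 2) (u>2 i))) ⟩
  ratio (numP x (suc B)) (denP x (suc B) * (poch (2 * x + 2) B * W x))
    ≡⟨ ratio-cross (*-mono-< (denP-pos x (suc B)) (*-mono-< (poch-pos B (subst (0 <_) (+-comm 2 (2 * x)) z<s)) (W-pos x)))
                   e>0 (*-mono-< (denP-pos (suc x) B) (W-pos x))
                   (scale (numP x (suc B)) (denP (suc x) B) (numP (suc x) B) (denP x (suc B)) (poch (2 * x + 2) B) (W x) (shift x)) ⟩
  ratio c e ℚ.* F b m u′ (suc x) ∎
  where
  open ≡-Reasoning
  B = b + m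
  u′ = λ i → u (Fin.suc i) ∸ 2
  W = λ x → denW b m u′ (suc x)
  W-pos : ∀ x → 0 < W x
  W-pos x = denW-pos b m u′ (suc x) (λ i → ∸-monoˡ-≤ 2 (u>2 i))
  scale : ∀ N₁ D₂ N₂ D₁ p V → N₁ * (e * D₂) ≡ c * N₂ * (D₁ * p) →
          N₁ * (e * (D₂ * V)) ≡ c * N₂ * (D₁ * (p * V))
  scale N₁ D₂ N₂ D₁ p V eq = begin
    N₁ * (e * (D₂ * V))     ≡⟨ assocˡ N₁ e D₂ V ⟩
    N₁ * (e * D₂) * V       ≡⟨ cong (_* V) eq ⟩
    c * N₂ * (D₁ * p) * V   ≡⟨ assocʳ c N₂ D₁ p V ⟩
    c * N₂ * (D₁ * (p * V)) ∎
    where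
    assocˡ : ∀ a b c d → a * (b * (c * d)) ≡ a * (b * c) * d
    assocˡ = solve-∀
    assocʳ : ∀ a b c d f → a * b * (c * d) * f ≡ a * b * (c * (d * f))
    assocʳ = solve-∀

mainTheorem10 : (a b m : ℕ) → (u : Fin (suc m) → ℕ) →
    Admissible b (suc m) u → 0 < f b (suc m) u a →
    (u zero ≡ 2 →
      ((λ x → F b (suc m) u x) ≡ₐ (λ x → F b m (λ i → u (suc i) ∸ 2) (suc x)))
      × (f b (suc m) u a ≡ f b m (λ i → u (suc i) ∸ 2) (suc a)))
    × (u (fromℕ m) ≡ b + 2 * suc m →
      ((λ x → F b (suc m) u x) ≡ₐ (λ x → F (suc b) m (λ i → u (inject₁ i)) x))
      × (f b (suc m) u a ≡ f (suc b) m (λ i → u (inject₁ i)) a))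
mainTheorem10 a b m u (bounds , increasing) _ =
    (λ u₀≡2 → F-firstEntryTwo b m u u₀≡2 (u>2 u₀≡2) , FirstEntryTwo.M-firstEntryTwo a b m u u₀≡2 (u>2 u₀≡2))
  , (λ u-last → F-lastEntryMax b m u u-last , LastEntryMax.M-lastEntryMax a b m u (proj₂ ∘ bounds) u-last)
  where
  u>2 : u zero ≡ 2 → ∀ i → 3 ≤ u (suc i)
  u>2 u₀≡2 i = subst (_< u (suc i)) u₀≡2 (increasing zero (suc i) (s≤s z≤n))
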